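{- For integers $p\geq 0$ and $q\geq 2$, the $\varepsilon$-polynomial $\det(\lambda I_n-\varepsilon(H_{p,q}))$ of $H_{p,q}$ (where $n=p+2q+1$) equals $$\lambda^{p+1}(\lambda^2+4\lambda-9)^{q-1}\big[\lambda^2+(4-4q)\lambda-(9pq+9q^2+9-14q)\big].$$
   Context: For a connected graph $G$, $d_G(u,v)$ is the distance and $e_G(u)=\max_{v} d_G(u,v)$ the eccentricity. The eccentricity matrix $\varepsilon(G)$ is the symmetric matrix indexed by $V(G)$ with $(\varepsilon(G))_{uv}=d_G(u,v)$ if $d_G(u,v)=\min\{e_G(u),e_G(v)\}$ and $(\varepsilon(G))_{uv}=0$ otherwise. For $p\geq 0$ and $q\geq 2$, $H_{p,q}$ is the tree obtained from the star $S_{p+q+1}$ (with $p+q$ leaves) by attaching one new pendant vertex to each of $q$ chosen leaves of the star; it has $p+2q+1$ vertices. -}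

module Defs where

open import Data.Bool using (Bool; true; false; _∧_; _∨_; if_then_else_)
open import Data.Nat as ℕ using (ℕ; zero; suc; _⊔_; _⊓_; _≡ᵇ_; _≤ᵇ_)
open import Data.Fin using (Fin; zero; suc; toℕ; punchIn)
open import Data.Fin.Properties using (_≟_)
open import Data.List using (List; foldr; map)
open import Data.Bool.ListAction using (any)
open import Data.List using () renaming (allFin to allFinL)
open import Data.Integer as ℤ using (ℤ; +_; -_)
open import Relation.Nullary.Decidable using (⌊_⌋)

Graph : ℕ → Set
Graph n = Fin n → Fin n → Bool

module _ {n : ℕ} (G : Graph n) where

  reach : ℕ → Fin n → Fin n → Bool
  reach zero    u v = ⌊ u ≟ v ⌋
  reach (suc k) u v = reach k u v ∨ any (λ w → G u w ∧ reach k w v) (allFinL n)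

  -- distance d_G(u,v): least k with a walk of length ≤ k from u to v.
  -- (In a connected graph on n vertices this is < n; the search
  -- over k = 0 … n-1 therefore finds it.)
  dist : Fin n → Fin n → ℕ
  dist u v = search 0 n
    where
    search : ℕ → ℕ → ℕ
    search k zero       = k
    search k (suc fuel) = if reach k u v then k else search (suc k) fuel

  ecc : Fin n → ℕ
  ecc u = foldr _⊔_ 0 (map (dist u) (allFinL n))

  eccMatrix : Fin n → Fin n → ℤ
  eccMatrix u v =
    if (dist u v ≡ᵇ (ecc u ⊓ ecc v)) then + dist u v else + 0

sgn : ℕ → ℤ
sgn zero          = + 1
sgn (suc zero)    = - + 1
sgn (suc (suc k)) = sgn k

det : (n : ℕ) → (Fin n → Fin n → ℤ) → ℤ
det zero    M = + 1
det (suc n) M =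
  foldr ℤ._+_ (+ 0)
    (map (λ j → sgn (toℕ j) ℤ.* (M zero j ℤ.* det n (λ i k → M (suc i) (punchIn j k))))
         (allFinL (suc n)))

charMat : (n : ℕ) → ℤ → (Fin n → Fin n → ℤ) → Fin n → Fin n → ℤ
charMat n x M i j = (if ⌊ i ≟ j ⌋ then x else + 0) ℤ.- M i j

-- The tree H_{p,q} on vertex set {0,…,p+2q}:
--   0            : centre of the star S_{p+q+1}
--   1 … p+q      : leaves of the star
--   p+q+1 … p+2q : new pendant vertices; vertex p+q+j is attached to
--                  the star leaf p+j  (j = 1 … q), i.e. the q chosen
--                  leaves are p+1 … p+q.

Hadj : ℕ → ℕ → ℕ → ℕ → Bool
Hadj p q i j =
  ((i ≡ᵇ 0) ∧ ((1 ≤ᵇ j) ∧ (j ≤ᵇ p ℕ.+ q)))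
  ∨ (((p ℕ.+ 1 ≤ᵇ i) ∧ (i ≤ᵇ p ℕ.+ q)) ∧ (j ≡ᵇ i ℕ.+ q))

H : (p q : ℕ) → Graph (p ℕ.+ 2 ℕ.* q ℕ.+ 1)
H p q u v = Hadj p q (toℕ u) (toℕ v) ∨ Hadj p q (toℕ v) (toℕ u)

-- In xI − ε(H_{p,q}) two star leaves without pendant, or two branches (a star leaf with its
-- pendant), are twins: their rows agree outside the columns of the twins, and so do their columns.
-- Subtracting the column of one twin from the other and adding its row back leaves a column that
-- vanishes off the diagonal, giving a factor x for a leaf, or two columns supported on the 2 × 2
-- block [[x, 3], [3, x + 4]], giving a factor x² + 4x − 9 for a branch.  The remaining minor has
-- the same shape, except that the surviving twin carries the weight of both.  Eliminating q − 1
-- branches and p − 1 leaves leaves a 3 × 3 or 4 × 4 determinant, evaluated by cofactor expansion.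

module Submission where

open import Defs
open import Data.Nat using (ℕ; _≤_; _∸_)
open import Data.Nat as ℕ using ()
open import Data.Integer using (ℤ; +_; _+_; _-_; _*_; _^_)
open import Relation.Binary.PropositionalEquality using (_≡_)

open import Data.Bool using (Bool; true; false; if_then_else_; T; _∧_; _∨_)
open import Data.Bool.Properties using (∨-zeroʳ; ∨-identityʳ)
open import Data.Bool.ListAction using (any)
open import Data.Empty using (⊥-elim)
open import Data.Fin using (Fin; zero; suc; toℕ; punchIn; fromℕ<; #_)
open import Data.Fin.Properties using (_≟_; suc-injective; toℕ-injective; toℕ<n; toℕ-fromℕ<)
open import Data.Integer using (-_)
open import Data.Integer.Properties as ℤ using ()
open import Algebra.Properties.Semiring.Sum ℤ.+-*-semiring
open import Data.Integer.Tactic.RingSolver using (solve-∀)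
open import Data.List using (foldr; map; tabulate; allFin)
open import Data.List.Properties using (map-tabulate)
open import Data.Nat using (zero; suc; _<_; _≤ᵇ_; _≡ᵇ_; _<ᵇ_; _⊔_; _⊓_; pred; z≤n; s≤s)
open import Data.Nat.Properties as ℕ using ()
open import Data.Nat.Tactic.RingSolver as ℕ-Solver using ()
open import Data.Product using (Σ-syntax; _×_; _,_; proj₁; proj₂)
open import Data.Sum using (_⊎_; inj₁; inj₂)
open import Data.Unit using (⊤; tt)
open import Function using (_∘_; id)
open import Relation.Nullary using (yes; no; ¬_)
open import Relation.Nullary.Decidable using (⌊_⌋)
open import Relation.Binary.PropositionalEquality

≡ᵇ-refl : ∀ m → (m ≡ᵇ m) ≡ true
≡ᵇ-refl zero    = refl
≡ᵇ-refl (suc m) = ≡ᵇ-refl m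

≡ᵇ-≢ : ∀ m n → m ≢ n → (m ≡ᵇ n) ≡ false
≡ᵇ-≢ zero    zero    m≢n = ⊥-elim (m≢n refl)
≡ᵇ-≢ zero    (suc n) _   = refl
≡ᵇ-≢ (suc m) zero    _   = refl
≡ᵇ-≢ (suc m) (suc n) m≢n = ≡ᵇ-≢ m n (m≢n ∘ cong suc)

≡ᵇ-sym : ∀ m n → (m ≡ᵇ n) ≡ (n ≡ᵇ m)
≡ᵇ-sym zero    zero    = refl
≡ᵇ-sym zero    (suc n) = refl
≡ᵇ-sym (suc m) zero    = refl
≡ᵇ-sym (suc m) (suc n) = ≡ᵇ-sym m n

≡ᵇ-+ˡ : ∀ a m n → (a ℕ.+ m ≡ᵇ a ℕ.+ n) ≡ (m ≡ᵇ n)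
≡ᵇ-+ˡ zero    m n = refl
≡ᵇ-+ˡ (suc a) m n = ≡ᵇ-+ˡ a m n

<ᵇ-true : ∀ {m n} → m < n → (m <ᵇ n) ≡ true
<ᵇ-true {m} {n} m<n with m <ᵇ n | ℕ.<⇒<ᵇ m<n
... | true | _ = refl

<ᵇ-false : ∀ {m n} → ¬ m < n → (m <ᵇ n) ≡ false
<ᵇ-false {m} {n} m≮n with m <ᵇ n in eq
... | false = refl
... | true  = ⊥-elim (m≮n (ℕ.<ᵇ⇒< m n (subst T (sym eq) tt)))

≤ᵇ-true : ∀ {m n} → m ≤ n → (m ≤ᵇ n) ≡ true
≤ᵇ-true {m} {n} m≤n with m ≤ᵇ n | ℕ.≤⇒≤ᵇ m≤n
... | true | _ = refl

≤ᵇ-false : ∀ {m n} → n < m → (m ≤ᵇ n) ≡ false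
≤ᵇ-false {m} {n} n<m with m ≤ᵇ n in eq
... | false = refl
... | true  = ⊥-elim (ℕ.<⇒≱ n<m (ℕ.≤ᵇ⇒≤ m n (subst T (sym eq) tt)))

≤ᵇ-sound : ∀ {m n} → (m ≤ᵇ n) ≡ true → m ≤ n
≤ᵇ-sound {m} {n} eq = ℕ.≤ᵇ⇒≤ m n (subst T (sym eq) tt)

if-cong : ∀ {A : Set} {b b′ : Bool} {x y : A} → b ≡ b′ → (if b then x else y) ≡ (if b′ then x else y)
if-cong refl = refl

-- Determinants

private variable
  n : ℕ

Matrix : ℕ → Set
Matrix n = Fin n → Fin n → ℤ

minor : Matrix (suc n) → Fin (suc n) → Fin (suc n) → Matrix n
minor M i j r s = M (punchIn i r) (punchIn j s)

transpose : Matrix n → Matrix n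
transpose M r s = M s r

sum-zero : (f : Fin n → ℤ) → (∀ i → f i ≡ + 0) → sum f ≡ + 0
sum-zero {n} f f≡0 = trans (sum-cong-≗ f≡0) (sum-replicate-zero n)

sgn-suc : ∀ k → sgn (suc k) ≡ - sgn k
sgn-suc zero          = refl
sgn-suc (suc zero)    = refl
sgn-suc (suc (suc k)) = sgn-suc k

sgn-+ : ∀ a b → sgn (a ℕ.+ b) ≡ sgn a * sgn b
sgn-+ zero          b = sym (ℤ.*-identityˡ (sgn b))
sgn-+ (suc zero)    b = trans (sgn-suc b) (sym (ℤ.-1*i≡-i (sgn b)))
sgn-+ (suc (suc a)) b = sgn-+ a b

sgn-square : ∀ k → sgn k * sgn k ≡ + 1
sgn-square zero          = refl
sgn-square (suc zero)    = refl
sgn-square (suc (suc k)) = sgn-square k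

sgn-double : ∀ k → sgn (k ℕ.+ k) ≡ + 1
sgn-double zero    = refl
sgn-double (suc k) = trans (cong (sgn ∘ suc) (ℕ.+-suc k k)) (sgn-double k)

term-vanishes : ∀ σ m {d} → d ≡ + 0 → σ * (m * d) ≡ + 0
term-vanishes σ m refl = trans (cong (σ *_) (ℤ.*-zeroʳ m)) (ℤ.*-zeroʳ σ)

foldr-+-tabulate : ∀ n (f : Fin n → ℤ) → foldr _+_ (+ 0) (tabulate f) ≡ sum f
foldr-+-tabulate zero    f = refl
foldr-+-tabulate (suc n) f = cong (_+_ (f zero)) (foldr-+-tabulate n (f ∘ suc))

det-expand : ∀ n (M : Matrix (suc n)) →
  det (suc n) M ≡ ∑[ j < suc n ] (sgn (toℕ j) * (M zero j * det n (minor M zero j)))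
det-expand n M = trans (cong (foldr _+_ (+ 0)) (map-tabulate id term))
                       (foldr-+-tabulate (suc n) term)
  where
  term : Fin (suc n) → ℤ
  term j = sgn (toℕ j) * (M zero j * det n (minor M zero j))

det-cong : ∀ n {M N : Matrix n} → (∀ r s → M r s ≡ N r s) → det n M ≡ det n N
det-cong zero    M≡N = refl
det-cong (suc n) {M} {N} M≡N = begin
  det (suc n) M                                                        ≡⟨ det-expand n M ⟩
  ∑[ j < suc n ] (sgn (toℕ j) * (M zero j * det n (minor M zero j))) ≡⟨ sum-cong-≗ term ⟩
  ∑[ j < suc n ] (sgn (toℕ j) * (N zero j * det n (minor N zero j))) ≡⟨ det-expand n N ⟨
  det (suc n) N                                                        ∎
  where
  open ≡-Reasoning
  term : ∀ j → sgn (toℕ j) * (M zero j * det n (minor M zero j))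
             ≡ sgn (toℕ j) * (N zero j * det n (minor N zero j))
  term j = cong₂ (λ a d → sgn (toℕ j) * (a * d)) (M≡N zero j)
                 (det-cong n (λ r s → M≡N (suc r) (punchIn j s)))

∑-swap-signed : ∀ n (a b : Fin n → ℤ) (D : Fin n → Fin n → ℤ) →
  ∑[ j < n ] (sgn (suc (toℕ j)) * (a j * ∑[ i < n ] (sgn (toℕ i) * (b i * D i j))))
  ≡ ∑[ i < n ] (sgn (suc (toℕ i)) * (b i * ∑[ j < n ] (sgn (toℕ j) * (a j * D i j))))
∑-swap-signed n a b D = begin
  ∑[ j < n ] (sgn (suc (toℕ j)) * (a j * ∑[ i < n ] (sgn (toℕ i) * (b i * D i j))))
    ≡⟨ sum-cong-≗ (λ j → trans (sym (ℤ.*-assoc (sgn (suc (toℕ j))) (a j) _))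
                               (*-distribˡ-sum (sgn (suc (toℕ j)) * a j) (λ i → sgn (toℕ i) * (b i * D i j)))) ⟩
  ∑[ j < n ] ∑[ i < n ] ((sgn (suc (toℕ j)) * a j) * (sgn (toℕ i) * (b i * D i j)))
    ≡⟨ ∑-comm (λ j i → (sgn (suc (toℕ j)) * a j) * (sgn (toℕ i) * (b i * D i j))) ⟩
  ∑[ i < n ] ∑[ j < n ] ((sgn (suc (toℕ j)) * a j) * (sgn (toℕ i) * (b i * D i j)))
    ≡⟨ sum-cong-≗ (λ i → sum-cong-≗ (λ j → rearrange (toℕ i) (toℕ j) (a j) (b i) (D i j))) ⟩
  ∑[ i < n ] ∑[ j < n ] ((sgn (suc (toℕ i)) * b i) * (sgn (toℕ j) * (a j * D i j)))
    ≡⟨ sum-cong-≗ (λ i → trans (sym (*-distribˡ-sum (sgn (suc (toℕ i)) * b i) (λ j → sgn (toℕ j) * (a j * D i j))))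
                               (ℤ.*-assoc (sgn (suc (toℕ i))) (b i) _)) ⟩
  ∑[ i < n ] (sgn (suc (toℕ i)) * (b i * ∑[ j < n ] (sgn (toℕ j) * (a j * D i j)))) ∎
  where
  open ≡-Reasoning
  rearrange : ∀ i j a b d → (sgn (suc j) * a) * (sgn i * (b * d)) ≡ (sgn (suc i) * b) * (sgn j * (a * d))
  rearrange i j a b d rewrite sgn-suc i | sgn-suc j = ring (sgn i) (sgn j) a b d
    where
    ring : ∀ si sj a b d → (- sj * a) * (si * (b * d)) ≡ (- si * b) * (sj * (a * d))
    ring = solve-∀

det-expand-column : ∀ n (M : Matrix (suc n)) →
  det (suc n) M ≡ ∑[ i < suc n ] (sgn (toℕ i) * (M i zero * det n (minor M i zero)))
det-expand-column zero    M = refl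
det-expand-column (suc n) M = begin
  det (suc (suc n)) M
    ≡⟨ det-expand (suc n) M ⟩
  corner + ∑[ j < suc n ] (sgn (toℕ (suc j)) * (M zero (suc j) * det (suc n) (minor M zero (suc j))))
    ≡⟨ cong (_+_ corner) (sum-cong-≗ λ j → cong (λ d → sgn (suc (toℕ j)) * (M zero (suc j) * d))
                                                (det-expand-column n (minor M zero (suc j)))) ⟩
  corner + ∑[ j < suc n ] (sgn (suc (toℕ j)) * (M zero (suc j) * ∑[ i < suc n ] (sgn (toℕ i) * (M (suc i) zero * D i j))))
    ≡⟨ cong (_+_ corner) (∑-swap-signed (suc n) (λ j → M zero (suc j)) (λ i → M (suc i) zero) D) ⟩
  corner + ∑[ i < suc n ] (sgn (suc (toℕ i)) * (M (suc i) zero * ∑[ j < suc n ] (sgn (toℕ j) * (M zero (suc j) * D i j))))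
    ≡⟨ cong (_+_ corner) (sum-cong-≗ λ i → cong (λ d → sgn (suc (toℕ i)) * (M (suc i) zero * d))
                                                (sym (det-expand n (minor M (suc i) zero)))) ⟩
  corner + ∑[ i < suc n ] (sgn (toℕ (suc i)) * (M (suc i) zero * det (suc n) (minor M (suc i) zero)))
    ∎
  where
  open ≡-Reasoning
  corner = sgn 0 * (M zero zero * det (suc n) (minor M zero zero))
  -- definitionally also the minor of minor M zero (suc j) at (i, zero)
  D : Fin (suc n) → Fin (suc n) → ℤ
  D i j = det n (minor (minor M (suc i) zero) zero j)

det-transpose : ∀ n (M : Matrix n) → det n (transpose M) ≡ det n M
det-transpose zero    M = refl
det-transpose (suc n) M = begin
  det (suc n) (transpose M)
    ≡⟨ det-expand n (transpose M) ⟩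
  ∑[ j < suc n ] (sgn (toℕ j) * (M j zero * det n (transpose (minor M j zero))))
    ≡⟨ sum-cong-≗ (λ j → cong (λ d → sgn (toℕ j) * (M j zero * d)) (det-transpose n (minor M j zero))) ⟩
  ∑[ j < suc n ] (sgn (toℕ j) * (M j zero * det n (minor M j zero)))
    ≡⟨ det-expand-column n M ⟨
  det (suc n) M ∎
  where open ≡-Reasoning

det-linear-row : ∀ n (M N₁ N₂ : Matrix n) (i : Fin n) (a b : ℤ) →
  (∀ s → M i s ≡ a * N₁ i s + b * N₂ i s) →
  (∀ r → r ≢ i → ∀ s → M r s ≡ N₁ r s) →
  (∀ r → r ≢ i → ∀ s → M r s ≡ N₂ r s) →
  det n M ≡ a * det n N₁ + b * det n N₂
det-linear-row (suc n) M N₁ N₂ i a b row-i rows₁ rows₂ = begin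
  det (suc n) M                  ≡⟨ det-expand n M ⟩
  ∑[ j < suc n ] (term M j)      ≡⟨ sum-cong-≗ (split i row-i rows₁ rows₂) ⟩
  ∑[ j < suc n ] (a * term N₁ j + b * term N₂ j)
    ≡⟨ ∑-distrib-+ (λ j → a * term N₁ j) (λ j → b * term N₂ j) ⟩
  ∑[ j < suc n ] (a * term N₁ j) + ∑[ j < suc n ] (b * term N₂ j)
    ≡⟨ cong₂ _+_ (sym (*-distribˡ-sum a (term N₁))) (sym (*-distribˡ-sum b (term N₂))) ⟩
  a * ∑[ j < suc n ] (term N₁ j) + b * ∑[ j < suc n ] (term N₂ j)
    ≡⟨ cong₂ (λ d₁ d₂ → a * d₁ + b * d₂) (det-expand n N₁) (det-expand n N₂) ⟨
  a * det (suc n) N₁ + b * det (suc n) N₂ ∎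
  where
  open ≡-Reasoning
  term : Matrix (suc n) → Fin (suc n) → ℤ
  term A j = sgn (toℕ j) * (A zero j * det n (minor A zero j))
  split : ∀ i → (∀ s → M i s ≡ a * N₁ i s + b * N₂ i s) → (∀ r → r ≢ i → ∀ s → M r s ≡ N₁ r s) →
          (∀ r → r ≢ i → ∀ s → M r s ≡ N₂ r s) → ∀ j → term M j ≡ a * term N₁ j + b * term N₂ j
  split zero row-i rows₁ rows₂ j
    rewrite row-i j | det-cong n (λ r s → rows₁ (suc r) (λ ()) (punchIn j s))
          | det-cong n {minor N₁ zero j} (λ r s → trans (sym (rows₁ (suc r) (λ ()) (punchIn j s)))
                                                          (rows₂ (suc r) (λ ()) (punchIn j s)))
    = ring a b (sgn (toℕ j)) (N₁ zero j) (N₂ zero j) (det n (minor N₂ zero j))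
    where
    ring : ∀ a b σ x y d → σ * ((a * x + b * y) * d) ≡ a * (σ * (x * d)) + b * (σ * (y * d))
    ring = solve-∀
  split (suc i) row-i rows₁ rows₂ j
    rewrite det-linear-row n (minor M zero j) (minor N₁ zero j) (minor N₂ zero j) i a b
              (λ s → row-i (punchIn j s))
              (λ r r≢i s → rows₁ (suc r) (r≢i ∘ suc-injective) (punchIn j s))
              (λ r r≢i s → rows₂ (suc r) (r≢i ∘ suc-injective) (punchIn j s))
          | sym (rows₁ zero (λ ()) j) | sym (rows₂ zero (λ ()) j)
    = ring a b (sgn (toℕ j)) (M zero j) (det n (minor N₁ zero j)) (det n (minor N₂ zero j))
    where
    ring : ∀ a b σ m d₁ d₂ → σ * (m * (a * d₁ + b * d₂)) ≡ a * (σ * (m * d₁)) + b * (σ * (m * d₂))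
    ring = solve-∀

mutual
  det-equal-first-rows : ∀ n (M : Matrix (suc (suc n))) → (∀ s → M zero s ≡ M (suc zero) s) →
                         det (suc (suc n)) M ≡ + 0
  det-equal-first-rows n M rows≡ = begin
    det (suc (suc n)) M
      ≡⟨ det-expand-column (suc n) M ⟩
    + 1 * (M zero zero * d₀) + (- + 1 * (M (suc zero) zero * d₁) + ∑[ r < n ] (rest r))
      ≡⟨ cong₂ (λ m d → + 1 * (M zero zero * d₀) + (- + 1 * (m * d) + ∑[ r < n ] (rest r)))
               (sym (rows≡ zero)) (det-cong (suc n) minor₁≡minor₀) ⟩
    + 1 * (M zero zero * d₀) + (- + 1 * (M zero zero * d₀) + ∑[ r < n ] (rest r))
      ≡⟨ cong (λ z → + 1 * (M zero zero * d₀) + (- + 1 * (M zero zero * d₀) + z))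
              (sum-zero rest (column-term-equal-first-rows n M rows≡)) ⟩
    + 1 * (M zero zero * d₀) + (- + 1 * (M zero zero * d₀) + + 0)
      ≡⟨ cancel (M zero zero * d₀) ⟩
    + 0 ∎
    where
    open ≡-Reasoning
    d₀ = det (suc n) (minor M zero zero)
    d₁ = det (suc n) (minor M (suc zero) zero)
    rest : Fin n → ℤ
    rest r = sgn (toℕ (suc (suc r))) * (M (suc (suc r)) zero * det (suc n) (minor M (suc (suc r)) zero))
    minor₁≡minor₀ : ∀ r s → minor M (suc zero) zero r s ≡ minor M zero zero r s
    minor₁≡minor₀ zero    s = rows≡ (suc s)
    minor₁≡minor₀ (suc r) s = refl
    cancel : ∀ x → + 1 * x + (- + 1 * x + + 0) ≡ + 0
    cancel = solve-∀

  column-term-equal-first-rows : ∀ n (M : Matrix (suc (suc n))) → (∀ s → M zero s ≡ M (suc zero) s) →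
    ∀ r → sgn (toℕ (suc (suc r))) * (M (suc (suc r)) zero * det (suc n) (minor M (suc (suc r)) zero)) ≡ + 0
  column-term-equal-first-rows (suc n) M rows≡ r
    = term-vanishes (sgn (toℕ r)) (M (suc (suc r)) zero)
        (det-equal-first-rows n (minor M (suc (suc r)) zero) (λ s → rows≡ (suc s)))

det-equal-adjacent-rows : ∀ n (M : Matrix n) (i k : Fin n) → toℕ k ≡ suc (toℕ i) →
                          (∀ s → M i s ≡ M k s) → det n M ≡ + 0
det-equal-adjacent-rows (suc (suc n)) M zero    (suc zero) _ rows≡ = det-equal-first-rows n M rows≡
det-equal-adjacent-rows (suc n) M (suc i) (suc k) k≡1+i rows≡ = begin
  det (suc n) M
    ≡⟨ det-expand n M ⟩
  ∑[ j < suc n ] (sgn (toℕ j) * (M zero j * det n (minor M zero j)))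
    ≡⟨ sum-zero _ (λ j → term-vanishes (sgn (toℕ j)) (M zero j) (minor-vanishes j)) ⟩
  + 0 ∎
  where
  open ≡-Reasoning
  minor-vanishes : ∀ j → det n (minor M zero j) ≡ + 0
  minor-vanishes j = det-equal-adjacent-rows n (minor M zero j) i k (ℕ.suc-injective k≡1+i)
                                             (λ s → rows≡ (punchIn j s))

Adjacent : Fin n → Fin n → Set
Adjacent i k = toℕ k ≡ suc (toℕ i) ⊎ toℕ i ≡ suc (toℕ k)

Adjacent⇒≢ : {i k : Fin n} → Adjacent i k → i ≢ k
Adjacent⇒≢ (inj₁ k≡1+i) refl = ℕ.1+n≢n (sym k≡1+i)
Adjacent⇒≢ (inj₂ i≡1+k) refl = ℕ.1+n≢n (sym i≡1+k)

overwriteRow : Matrix n → Fin n → Fin n → Matrix n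
overwriteRow M i k r with r ≟ i
... | yes _ = M k
... | no  _ = M r

det-add-row : ∀ n (M N : Matrix n) (i k : Fin n) (c : ℤ) → Adjacent i k →
  (∀ s → N i s ≡ M i s + c * M k s) → (∀ r → r ≢ i → ∀ s → N r s ≡ M r s) →
  det n N ≡ det n M
det-add-row n M N i k c adj row-i rows = begin
  det n N                          ≡⟨ det-linear-row n N M M′ i (+ 1) c split-i rows rows′ ⟩
  + 1 * det n M + c * det n M′     ≡⟨ cong (λ d → + 1 * det n M + c * d) M′-singular ⟩
  + 1 * det n M + c * + 0          ≡⟨ cleanup (det n M) c ⟩
  det n M                          ∎
  where
  open ≡-Reasoning
  M′ = overwriteRow M i k
  M′-i : ∀ s → M′ i s ≡ M k s
  M′-i s with i ≟ i
  ... | yes _   = refl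
  ... | no  i≢i = ⊥-elim (i≢i refl)
  M′-other : ∀ r → r ≢ i → ∀ s → M′ r s ≡ M r s
  M′-other r r≢i s with r ≟ i
  ... | yes r≡i = ⊥-elim (r≢i r≡i)
  ... | no  _   = refl
  split-i : ∀ s → N i s ≡ + 1 * M i s + c * M′ i s
  split-i s = trans (row-i s) (cong₂ _+_ (sym (ℤ.*-identityˡ (M i s))) (cong (c *_) (sym (M′-i s))))
  rows′ : ∀ r → r ≢ i → ∀ s → N r s ≡ M′ r s
  rows′ r r≢i s = trans (rows r r≢i s) (sym (M′-other r r≢i s))
  M′-rows≡ : ∀ s → M′ i s ≡ M′ k s
  M′-rows≡ s = trans (M′-i s) (sym (M′-other k (Adjacent⇒≢ adj ∘ sym) s))
  M′-singular : det n M′ ≡ + 0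
  M′-singular = singular adj
    where
    singular : Adjacent i k → det n M′ ≡ + 0
    singular (inj₁ k≡1+i) = det-equal-adjacent-rows n M′ i k k≡1+i M′-rows≡
    singular (inj₂ i≡1+k) = det-equal-adjacent-rows n M′ k i i≡1+k (sym ∘ M′-rows≡)
  cleanup : ∀ d c → + 1 * d + c * + 0 ≡ d
  cleanup = solve-∀

det-add-column : ∀ n (M N : Matrix n) (j k : Fin n) (c : ℤ) → Adjacent j k →
  (∀ r → N r j ≡ M r j + c * M r k) → (∀ r s → s ≢ j → N r s ≡ M r s) →
  det n N ≡ det n M
det-add-column n M N j k c adj col-j cols = begin
  det n N                ≡⟨ det-transpose n N ⟨
  det n (transpose N)    ≡⟨ det-add-row n (transpose M) (transpose N) j k c adj col-j (λ s s≢j r → cols r s s≢j) ⟩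
  det n (transpose M)    ≡⟨ det-transpose n M ⟩
  det n M                ∎
  where open ≡-Reasoning

det-zero-row : ∀ n (M : Matrix n) (i : Fin n) → (∀ s → M i s ≡ + 0) → det n M ≡ + 0
det-zero-row (suc n) M zero row≡0 = trans (det-expand n M) (sum-zero _ vanishes)
  where
  vanishes : ∀ j → sgn (toℕ j) * (M zero j * det n (minor M zero j)) ≡ + 0
  vanishes j rewrite row≡0 j = ℤ.*-zeroʳ (sgn (toℕ j))
det-zero-row (suc n) M (suc i) row≡0 = trans (det-expand n M) (sum-zero _ vanishes)
  where
  vanishes : ∀ j → sgn (toℕ j) * (M zero j * det n (minor M zero j)) ≡ + 0
  vanishes j = term-vanishes (sgn (toℕ j)) (M zero j) (det-zero-row n (minor M zero j) i (row≡0 ∘ punchIn j))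

det-zero-column : ∀ n (M : Matrix n) (k : Fin n) → (∀ r → M r k ≡ + 0) → det n M ≡ + 0
det-zero-column n M k col≡0 = trans (sym (det-transpose n M)) (det-zero-row n (transpose M) k col≡0)

-- The position of k among the indices that remain once punchIn k j is deleted.
remainingIndex : Fin (suc (suc n)) → Fin (suc n) → Fin (suc n)
remainingIndex zero    j       = zero
remainingIndex (suc k) zero    = k
remainingIndex {suc n} (suc k) (suc j) = suc (remainingIndex k j)

punchIn-remainingIndex : ∀ (k : Fin (suc (suc n))) j → punchIn (punchIn k j) (remainingIndex k j) ≡ k
punchIn-remainingIndex zero    j       = refl
punchIn-remainingIndex (suc k) zero    = refl
punchIn-remainingIndex {suc n} (suc k) (suc j) = cong suc (punchIn-remainingIndex k j)

punchIn-punchIn-remainingIndex : ∀ (k : Fin (suc (suc n))) j s →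
  punchIn (punchIn k j) (punchIn (remainingIndex k j) s) ≡ punchIn k (punchIn j s)
punchIn-punchIn-remainingIndex zero    j       s       = refl
punchIn-punchIn-remainingIndex (suc k) zero    s       = refl
punchIn-punchIn-remainingIndex {suc n} (suc k) (suc j) zero    = refl
punchIn-punchIn-remainingIndex {suc n} (suc k) (suc j) (suc s) = cong suc (punchIn-punchIn-remainingIndex k j s)

sgn-remainingIndex : ∀ (k : Fin (suc (suc n))) j →
  sgn (toℕ (punchIn k j) ℕ.+ toℕ (remainingIndex k j)) ≡ - sgn (toℕ k ℕ.+ toℕ j)
sgn-remainingIndex zero    j = trans (sgn-suc (toℕ j ℕ.+ 0)) (cong (-_ ∘ sgn) (ℕ.+-identityʳ (toℕ j)))
sgn-remainingIndex (suc k) zero = begin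
  sgn (toℕ k)              ≡⟨ ℤ.neg-involutive (sgn (toℕ k)) ⟨
  - - sgn (toℕ k)          ≡⟨ cong -_ (sgn-suc (toℕ k)) ⟨
  - sgn (suc (toℕ k))      ≡⟨ cong (-_ ∘ sgn ∘ suc) (ℕ.+-identityʳ (toℕ k)) ⟨
  - sgn (suc (toℕ k ℕ.+ 0)) ∎
  where open ≡-Reasoning
sgn-remainingIndex {suc n} (suc k) (suc j) = begin
  sgn (suc (toℕ (punchIn k j)) ℕ.+ suc (toℕ (remainingIndex k j)))
    ≡⟨ cong (sgn ∘ suc) (ℕ.+-suc (toℕ (punchIn k j)) _) ⟩
  sgn (toℕ (punchIn k j) ℕ.+ toℕ (remainingIndex k j))
    ≡⟨ sgn-remainingIndex k j ⟩
  - sgn (toℕ k ℕ.+ toℕ j)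
    ≡⟨ cong (-_ ∘ sgn ∘ suc) (ℕ.+-suc (toℕ k) (toℕ j)) ⟨
  - sgn (suc (toℕ k) ℕ.+ suc (toℕ j)) ∎
  where open ≡-Reasoning

cofactor-sign : ∀ i k j ρ π → sgn π * sgn ρ ≡ - (sgn k * sgn j) → ∀ a m d →
  sgn π * (a * (sgn (i ℕ.+ ρ) * (m * d))) ≡ (sgn (suc i ℕ.+ k) * m) * (sgn j * (a * d))
cofactor-sign i k j ρ π signs a m d
  rewrite sgn-+ i ρ | sgn-suc (i ℕ.+ k) | sgn-+ i k = begin
    sgn π * (a * ((sgn i * sgn ρ) * (m * d)))      ≡⟨ regroup (sgn π) (sgn ρ) (sgn i) a m d ⟩
    (sgn π * sgn ρ) * (sgn i * (a * (m * d)))      ≡⟨ cong (λ σ → σ * (sgn i * (a * (m * d)))) signs ⟩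
    - (sgn k * sgn j) * (sgn i * (a * (m * d)))    ≡⟨ regroup′ (sgn k) (sgn j) (sgn i) a m d ⟩
    (- (sgn i * sgn k) * m) * (sgn j * (a * d))    ∎
  where
  open ≡-Reasoning
  regroup : ∀ P R I a m d → P * (a * ((I * R) * (m * d))) ≡ (P * R) * (I * (a * (m * d)))
  regroup = solve-∀
  regroup′ : ∀ K J I a m d → - (K * J) * (I * (a * (m * d))) ≡ (- (I * K) * m) * (J * (a * d))
  regroup′ = solve-∀

minor-with-zero-column : ∀ n (M : Matrix (suc n)) k → (∀ r → r ≢ zero → M r k ≡ + 0) →
                         ∀ j → det n (minor M zero (punchIn k j)) ≡ + 0
minor-with-zero-column (suc n) M k col-k j =
  det-zero-column (suc n) (minor M zero (punchIn k j)) (remainingIndex k j)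
    (λ r → trans (cong (M (suc r)) (punchIn-remainingIndex k j)) (col-k (suc r) (λ ())))

det-single-entry-column : ∀ n (M : Matrix (suc n)) (i k : Fin (suc n)) → (∀ r → r ≢ i → M r k ≡ + 0) →
  det (suc n) M ≡ sgn (toℕ i ℕ.+ toℕ k) * (M i k * det n (minor M i k))
det-single-entry-column n M zero k col-k = begin
  det (suc n) M                                 ≡⟨ det-expand n M ⟩
  ∑[ j < suc n ] (term j)                       ≡⟨ sum-remove {i = k} term ⟩
  term k + ∑[ j < n ] (term (punchIn k j))      ≡⟨ cong (_+_ (term k)) (sum-zero _ vanishes) ⟩
  term k + + 0                                  ≡⟨ ℤ.+-identityʳ (term k) ⟩
  term k                                        ∎
  where
  open ≡-Reasoning
  term : Fin (suc n) → ℤ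
  term j = sgn (toℕ j) * (M zero j * det n (minor M zero j))
  vanishes : ∀ j → term (punchIn k j) ≡ + 0
  vanishes j = term-vanishes (sgn (toℕ (punchIn k j))) (M zero (punchIn k j)) (minor-with-zero-column n M k col-k j)
det-single-entry-column (suc n) M (suc i) k col-k = begin
  det (suc (suc n)) M                                    ≡⟨ det-expand (suc n) M ⟩
  ∑[ j < suc (suc n) ] (term j)                          ≡⟨ sum-remove {i = k} term ⟩
  term k + ∑[ j < suc n ] (term (punchIn k j))           ≡⟨ cong₂ _+_ top-vanishes (sum-cong-≗ term-factors) ⟩
  + 0 + ∑[ j < suc n ] (c * cofactor j)                  ≡⟨ ℤ.+-identityˡ (∑[ j < suc n ] (c * cofactor j)) ⟩
  ∑[ j < suc n ] (c * cofactor j)                        ≡⟨ *-distribˡ-sum c cofactor ⟨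
  c * ∑[ j < suc n ] (cofactor j)                        ≡⟨ cong (c *_) (det-expand n (minor M (suc i) k)) ⟨
  c * det (suc n) (minor M (suc i) k)                    ≡⟨ ℤ.*-assoc (sgn (suc (toℕ i) ℕ.+ toℕ k)) (M (suc i) k) _ ⟩
  sgn (suc (toℕ i) ℕ.+ toℕ k) * (M (suc i) k * det (suc n) (minor M (suc i) k)) ∎
  where
  open ≡-Reasoning
  term : Fin (suc (suc n)) → ℤ
  term j = sgn (toℕ j) * (M zero j * det (suc n) (minor M zero j))
  c = sgn (suc (toℕ i) ℕ.+ toℕ k) * M (suc i) k
  cofactor : Fin (suc n) → ℤ
  cofactor j = sgn (toℕ j) * (M zero (punchIn k j) * det n (minor (minor M (suc i) k) zero j))
  top-vanishes : term k ≡ + 0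
  top-vanishes rewrite col-k zero (λ ()) = ℤ.*-zeroʳ (sgn (toℕ k))
  term-factors : ∀ j → term (punchIn k j) ≡ c * cofactor j
  term-factors j = begin
    sgn (toℕ pk) * (M zero pk * det (suc n) (minor M zero pk))
      ≡⟨ cong (λ d → sgn (toℕ pk) * (M zero pk * d))
              (det-single-entry-column n (minor M zero pk) i ρ
                 (λ r r≢i → trans (cong (M (suc r)) (punchIn-remainingIndex k j)) (col-k (suc r) (r≢i ∘ suc-injective)))) ⟩
    sgn (toℕ pk) * (M zero pk * (sgn (toℕ i ℕ.+ toℕ ρ) * (M (suc i) (punchIn pk ρ) * det n (minor (minor M zero pk) i ρ))))
      ≡⟨ cong₂ (λ m d → sgn (toℕ pk) * (M zero pk * (sgn (toℕ i ℕ.+ toℕ ρ) * (m * d))))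
               (cong (M (suc i)) (punchIn-remainingIndex k j))
               (det-cong n (λ r s → cong (M (suc (punchIn i r))) (punchIn-punchIn-remainingIndex k j s))) ⟩
    sgn (toℕ pk) * (M zero pk * (sgn (toℕ i ℕ.+ toℕ ρ) * (M (suc i) k * det n (minor (minor M (suc i) k) zero j))))
      ≡⟨ cofactor-sign (toℕ i) (toℕ k) (toℕ j) (toℕ ρ) (toℕ pk) signs (M zero pk) (M (suc i) k) _ ⟩
    c * cofactor j ∎
    where
    pk = punchIn k j
    ρ = remainingIndex k j
    signs : sgn (toℕ pk) * sgn (toℕ ρ) ≡ - (sgn (toℕ k) * sgn (toℕ j))
    signs = trans (sym (sgn-+ (toℕ pk) (toℕ ρ))) (trans (sgn-remainingIndex k j) (cong -_ (sgn-+ (toℕ k) (toℕ j))))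

det-1 : ∀ (M : Matrix 1) → det 1 M ≡ M zero zero
det-1 M = ring (M zero zero)
  where ring : ∀ a → + 1 * (a * + 1) + + 0 ≡ a
        ring = solve-∀

det-2 : ∀ (M : Matrix 2) → det 2 M ≡ M zero zero * M (suc zero) (suc zero) - M zero (suc zero) * M (suc zero) zero
det-2 M = trans (cong₂ (λ d₀ d₁ → + 1 * (M zero zero * d₀) + (- + 1 * (M zero (suc zero) * d₁) + + 0))
                       (det-1 (minor M zero zero)) (det-1 (minor M zero (suc zero))))
                (ring (M zero zero) (M zero (suc zero)) (M (suc zero) zero) (M (suc zero) (suc zero)))
  where ring : ∀ a b c d → + 1 * (a * d) + (- + 1 * (b * c) + + 0) ≡ a * d - b * c
        ring = solve-∀

det-3 : ∀ (M : Matrix 3) → det 3 M ≡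
  M (# 0) (# 0) * (M (# 1) (# 1) * M (# 2) (# 2) - M (# 1) (# 2) * M (# 2) (# 1))
  - M (# 0) (# 1) * (M (# 1) (# 0) * M (# 2) (# 2) - M (# 1) (# 2) * M (# 2) (# 0))
  + M (# 0) (# 2) * (M (# 1) (# 0) * M (# 2) (# 1) - M (# 1) (# 1) * M (# 2) (# 0))
det-3 M =
  trans (cong₃ (λ d₀ d₁ d₂ → + 1 * (M (# 0) (# 0) * d₀) + (- + 1 * (M (# 0) (# 1) * d₁) + (+ 1 * (M (# 0) (# 2) * d₂) + + 0)))
               (det-2 (minor M zero zero)) (det-2 (minor M zero (# 1))) (det-2 (minor M zero (# 2))))
        (ring (M (# 0) (# 0)) (M (# 0) (# 1)) (M (# 0) (# 2)) (M (# 1) (# 0) * M (# 2) (# 1) - M (# 1) (# 1) * M (# 2) (# 0))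
              (M (# 1) (# 0) * M (# 2) (# 2) - M (# 1) (# 2) * M (# 2) (# 0)) (M (# 1) (# 1) * M (# 2) (# 2) - M (# 1) (# 2) * M (# 2) (# 1)))
  where
  cong₃ : ∀ {A : Set} (f : ℤ → ℤ → ℤ → A) {a a′ b b′ c c′} → a ≡ a′ → b ≡ b′ → c ≡ c′ → f a b c ≡ f a′ b′ c′
  cong₃ f refl refl refl = refl
  ring : ∀ a b c C B A → + 1 * (a * A) + (- + 1 * (b * B) + (+ 1 * (c * C) + + 0)) ≡ a * A - b * B + c * C
  ring = solve-∀

det-4 : ∀ (M : Matrix 4) → det 4 M ≡
  M (# 0) (# 0) * det 3 (minor M zero zero) - M (# 0) (# 1) * det 3 (minor M zero (# 1))
  + M (# 0) (# 2) * det 3 (minor M zero (# 2)) - M (# 0) (# 3) * det 3 (minor M zero (# 3))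
det-4 M = ring (M (# 0) (# 0)) (M (# 0) (# 1)) (M (# 0) (# 2)) (M (# 0) (# 3))
               (det 3 (minor M zero zero)) (det 3 (minor M zero (# 1))) (det 3 (minor M zero (# 2))) (det 3 (minor M zero (# 3)))
  where
  ring : ∀ a b c d A B C D →
         + 1 * (a * A) + (- + 1 * (b * B) + (+ 1 * (c * C) + (- + 1 * (d * D) + + 0))) ≡ a * A - b * B + c * C - d * D
  ring = solve-∀

matrix : (n : ℕ) → (ℕ → ℕ → ℤ) → Matrix n
matrix n f r s = f (toℕ r) (toℕ s)

punchInℕ : ℕ → ℕ → ℕ
punchInℕ zero    v       = suc v
punchInℕ (suc k) zero    = zero
punchInℕ (suc k) (suc v) = suc (punchInℕ k v)

minorℕ : (ℕ → ℕ → ℤ) → ℕ → ℕ → ℕ → ℕ → ℤ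
minorℕ f i k v w = f (punchInℕ i v) (punchInℕ k w)

toℕ-punchIn : ∀ (i : Fin (suc n)) r → toℕ (punchIn i r) ≡ punchInℕ (toℕ i) (toℕ r)
toℕ-punchIn zero    r       = refl
toℕ-punchIn (suc i) zero    = refl
toℕ-punchIn (suc i) (suc r) = cong suc (toℕ-punchIn i r)

punchInℕ-< : ∀ {k v} → v < k → punchInℕ k v ≡ v
punchInℕ-< {suc k} {zero}  _         = refl
punchInℕ-< {suc k} {suc v} (s≤s v<k) = cong suc (punchInℕ-< v<k)

punchInℕ-≥ : ∀ {k v} → k ≤ v → punchInℕ k v ≡ suc v
punchInℕ-≥ {zero}  {v}     _         = refl
punchInℕ-≥ {suc k} {suc v} (s≤s k≤v) = cong suc (punchInℕ-≥ k≤v)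

punchInℕ-≢ : ∀ k v → punchInℕ k v ≢ k
punchInℕ-≢ (suc k) (suc v) eq = punchInℕ-≢ k v (ℕ.suc-injective eq)

punchInℕ-≤ : ∀ k v → punchInℕ k v ≤ suc v
punchInℕ-≤ zero    v       = ℕ.≤-refl
punchInℕ-≤ (suc k) zero    = z≤n
punchInℕ-≤ (suc k) (suc v) = s≤s (punchInℕ-≤ k v)

det-matrix-cong : ∀ n {f g : ℕ → ℕ → ℤ} → (∀ v w → v < n → w < n → f v w ≡ g v w) →
                  det n (matrix n f) ≡ det n (matrix n g)
det-matrix-cong n f≡g = det-cong n (λ r s → f≡g (toℕ r) (toℕ s) (toℕ<n r) (toℕ<n s))

det-minor-matrix : ∀ n f (i k : Fin (suc n)) →
  det n (minor (matrix (suc n) f) i k) ≡ det n (matrix n (minorℕ f (toℕ i) (toℕ k)))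
det-minor-matrix n f i k = det-cong n (λ r s → cong₂ f (toℕ-punchIn i r) (toℕ-punchIn k s))

private
  toℕ≢ : ∀ {i} (i<n : i < n) {r : Fin n} → r ≢ fromℕ< i<n → toℕ r ≢ i
  toℕ≢ i<n r≢i refl = r≢i (toℕ-injective (sym (toℕ-fromℕ< i<n)))

  adjacent-fromℕ< : ∀ {i k} (i<n : i < n) (k<n : k < n) → k ≡ suc i ⊎ i ≡ suc k → Adjacent (fromℕ< i<n) (fromℕ< k<n)
  adjacent-fromℕ< i<n k<n rewrite toℕ-fromℕ< i<n | toℕ-fromℕ< k<n = id

det-add-rowℕ : ∀ n (f g : ℕ → ℕ → ℤ) {i k} (c : ℤ) → i < n → k < n → k ≡ suc i ⊎ i ≡ suc k →
  (∀ u → g i u ≡ f i u + c * f k u) → (∀ v u → v < n → v ≢ i → g v u ≡ f v u) →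
  det n (matrix n g) ≡ det n (matrix n f)
det-add-rowℕ n f g {i} {k} c i<n k<n adj row-i rows =
  det-add-row n (matrix n f) (matrix n g) (fromℕ< i<n) (fromℕ< k<n) c (adjacent-fromℕ< i<n k<n adj)
    (λ s → subst₂ (λ a b → g a (toℕ s) ≡ f a (toℕ s) + c * f b (toℕ s))
                  (sym (toℕ-fromℕ< i<n)) (sym (toℕ-fromℕ< k<n)) (row-i (toℕ s)))
    (λ r r≢i s → rows (toℕ r) (toℕ s) (toℕ<n r) (toℕ≢ i<n r≢i))

det-add-columnℕ : ∀ n (f g : ℕ → ℕ → ℤ) {j k} (c : ℤ) → j < n → k < n → k ≡ suc j ⊎ j ≡ suc k →
  (∀ v → g v j ≡ f v j + c * f v k) → (∀ v u → u < n → u ≢ j → g v u ≡ f v u) →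
  det n (matrix n g) ≡ det n (matrix n f)
det-add-columnℕ n f g {j} {k} c j<n k<n adj col-j cols =
  det-add-column n (matrix n f) (matrix n g) (fromℕ< j<n) (fromℕ< k<n) c (adjacent-fromℕ< j<n k<n adj)
    (λ r → subst₂ (λ a b → g (toℕ r) a ≡ f (toℕ r) a + c * f (toℕ r) b)
                  (sym (toℕ-fromℕ< j<n)) (sym (toℕ-fromℕ< k<n)) (col-j (toℕ r)))
    (λ r s s≢j → cols (toℕ r) (toℕ s) (toℕ<n s) (toℕ≢ j<n s≢j))

det-single-entry-columnℕ : ∀ n (f : ℕ → ℕ → ℤ) {i k} → i < suc n → k < suc n →
  (∀ v → v < suc n → v ≢ i → f v k ≡ + 0) →
  det (suc n) (matrix (suc n) f) ≡ sgn (i ℕ.+ k) * (f i k * det n (matrix n (minorℕ f i k)))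
det-single-entry-columnℕ n f {i} {k} i<n k<n col-k = begin
  det (suc n) (matrix (suc n) f)
    ≡⟨ det-single-entry-column n (matrix (suc n) f) I K
         (λ r r≢I → subst (λ b → f (toℕ r) b ≡ + 0) (sym (toℕ-fromℕ< k<n)) (col-k (toℕ r) (toℕ<n r) (toℕ≢ i<n r≢I))) ⟩
  sgn (toℕ I ℕ.+ toℕ K) * (f (toℕ I) (toℕ K) * det n (minor (matrix (suc n) f) I K))
    ≡⟨ cong (λ d → sgn (toℕ I ℕ.+ toℕ K) * (f (toℕ I) (toℕ K) * d)) (det-minor-matrix n f I K) ⟩
  sgn (toℕ I ℕ.+ toℕ K) * (f (toℕ I) (toℕ K) * det n (matrix n (minorℕ f (toℕ I) (toℕ K))))
    ≡⟨ cong₂ (λ a b → sgn (a ℕ.+ b) * (f a b * det n (matrix n (minorℕ f a b)))) (toℕ-fromℕ< i<n) (toℕ-fromℕ< k<n) ⟩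
  sgn (i ℕ.+ k) * (f i k * det n (matrix n (minorℕ f i k))) ∎
  where
  open ≡-Reasoning
  I = fromℕ< i<n
  K = fromℕ< k<n

det-diagonal-entry-columnℕ : ∀ n (f : ℕ → ℕ → ℤ) {k} → k < suc n →
  (∀ v → v < suc n → v ≢ k → f v k ≡ + 0) →
  det (suc n) (matrix (suc n) f) ≡ f k k * det n (matrix n (minorℕ f k k))
det-diagonal-entry-columnℕ n f {k} k<n col-k =
  trans (det-single-entry-columnℕ n f k<n k<n col-k)
        (trans (cong (_* (f k k * det n (matrix n (minorℕ f k k)))) (sgn-double k)) (ℤ.*-identityˡ _))

det-linear-columnℕ : ∀ n (f g₁ g₂ : ℕ → ℕ → ℤ) {k} (a₁ a₂ : ℤ) → k < n →
  (∀ v → v < n → f v k ≡ a₁ * g₁ v k + a₂ * g₂ v k) →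
  (∀ v u → v < n → u < n → u ≢ k → f v u ≡ g₁ v u) →
  (∀ v u → v < n → u < n → u ≢ k → f v u ≡ g₂ v u) →
  det n (matrix n f) ≡ a₁ * det n (matrix n g₁) + a₂ * det n (matrix n g₂)
det-linear-columnℕ n f g₁ g₂ {k} a₁ a₂ k<n col-k cols₁ cols₂ = begin
  det n (matrix n f)
    ≡⟨ det-transpose n (matrix n f) ⟨
  det n (transpose (matrix n f))
    ≡⟨ det-linear-row n _ _ _ (fromℕ< k<n) a₁ a₂
         (λ s → subst (λ b → f (toℕ s) b ≡ a₁ * g₁ (toℕ s) b + a₂ * g₂ (toℕ s) b)
                      (sym (toℕ-fromℕ< k<n)) (col-k (toℕ s) (toℕ<n s)))
         (λ r r≢k s → cols₁ (toℕ s) (toℕ r) (toℕ<n s) (toℕ<n r) (toℕ≢ k<n r≢k))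
         (λ r r≢k s → cols₂ (toℕ s) (toℕ r) (toℕ<n s) (toℕ<n r) (toℕ≢ k<n r≢k)) ⟩
  a₁ * det n (transpose (matrix n g₁)) + a₂ * det n (transpose (matrix n g₂))
    ≡⟨ cong₂ (λ d₁ d₂ → a₁ * d₁ + a₂ * d₂) (det-transpose n (matrix n g₁)) (det-transpose n (matrix n g₂)) ⟩
  a₁ * det n (matrix n g₁) + a₂ * det n (matrix n g₂) ∎
  where open ≡-Reasoning

unitColumn : ℕ → ℕ → (ℕ → ℕ → ℤ) → ℕ → ℕ → ℤ
unitColumn k i f v u = if u ≡ᵇ k then (if v ≡ᵇ i then + 1 else + 0) else f v u

unitColumn-≢ : ∀ k i f v {u} → u ≢ k → unitColumn k i f v u ≡ f v u
unitColumn-≢ k i f v {u} u≢k rewrite ≡ᵇ-≢ u k u≢k = refl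

unitColumn-diagonal : ∀ k i f → unitColumn k i f i k ≡ + 1
unitColumn-diagonal k i f rewrite ≡ᵇ-refl k | ≡ᵇ-refl i = refl

unitColumn-off : ∀ k i f {v} → v ≢ i → unitColumn k i f v k ≡ + 0
unitColumn-off k i f {v} v≢i rewrite ≡ᵇ-refl k | ≡ᵇ-≢ v i v≢i = refl

-- Column b = m + 1 is split into its two unit columns; each summand is expanded along column b
-- and then along column a.
module _ (m : ℕ) (f : ℕ → ℕ → ℤ) {a : ℕ} (a<b : a < suc m)
  (col-a : ∀ v → v < suc (suc m) → v ≢ a → v ≢ suc m → f v a ≡ + 0)
  (col-b : ∀ v → v < suc (suc m) → v ≢ a → v ≢ suc m → f v (suc m) ≡ + 0) where

  private
    b = suc m
    D = det m (matrix m (minorℕ f a a))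

    a≢b : a ≢ b
    a≢b = ℕ.<⇒≢ a<b

    below-b : ∀ {v} → v < m → punchInℕ a v < b
    below-b v<m = s≤s (ℕ.≤-trans (punchInℕ-≤ a _) v<m)

  det-unitColumn-diagonal : det (suc b) (matrix (suc b) (unitColumn b b f)) ≡ f a a * D
  det-unitColumn-diagonal = begin
    det (suc b) (matrix (suc b) (unitColumn b b f))
      ≡⟨ det-diagonal-entry-columnℕ b (unitColumn b b f) ℕ.≤-refl (λ v _ v≢b → unitColumn-off b b f v≢b) ⟩
    unitColumn b b f b b * det b (matrix b (minorℕ (unitColumn b b f) b b))
      ≡⟨ cong₂ _*_ (unitColumn-diagonal b b f)
           (det-matrix-cong b (λ v w v<b w<b → trans (cong₂ (unitColumn b b f) (punchInℕ-< v<b) (punchInℕ-< w<b))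
                                                     (unitColumn-≢ b b f v (ℕ.<⇒≢ w<b)))) ⟩
    + 1 * det b (matrix b f)
      ≡⟨ ℤ.*-identityˡ _ ⟩
    det b (matrix b f)
      ≡⟨ det-diagonal-entry-columnℕ m f a<b (λ v v<b v≢a → col-a v (ℕ.m≤n⇒m≤1+n v<b) v≢a (ℕ.<⇒≢ v<b)) ⟩
    f a a * D ∎
    where open ≡-Reasoning

  det-unitColumn-off-diagonal : det (suc b) (matrix (suc b) (unitColumn b a f)) ≡ sgn (a ℕ.+ b) * (sgn (m ℕ.+ a) * (f b a * D))
  det-unitColumn-off-diagonal = begin
    det (suc b) (matrix (suc b) (unitColumn b a f))
      ≡⟨ det-single-entry-columnℕ b (unitColumn b a f) (ℕ.m≤n⇒m≤1+n a<b) ℕ.≤-refl (λ v _ v≢a → unitColumn-off b a f v≢a) ⟩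
    sgn (a ℕ.+ b) * (unitColumn b a f a b * det b (matrix b h))
      ≡⟨ cong (λ g → sgn (a ℕ.+ b) * (g * det b (matrix b h))) (unitColumn-diagonal b a f) ⟩
    sgn (a ℕ.+ b) * (+ 1 * det b (matrix b h))
      ≡⟨ cong (sgn (a ℕ.+ b) *_) (ℤ.*-identityˡ _) ⟩
    sgn (a ℕ.+ b) * det b (matrix b h)
      ≡⟨ cong (sgn (a ℕ.+ b) *_) (det-single-entry-columnℕ m h ℕ.≤-refl a<b col-a-of-h) ⟩
    sgn (a ℕ.+ b) * (sgn (m ℕ.+ a) * (h m a * det m (matrix m (minorℕ h m a))))
      ≡⟨ cong₂ (λ x d → sgn (a ℕ.+ b) * (sgn (m ℕ.+ a) * (x * d))) h-m-a minor-h ⟩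
    sgn (a ℕ.+ b) * (sgn (m ℕ.+ a) * (f b a * D)) ∎
    where
    open ≡-Reasoning
    h = minorℕ (unitColumn b a f) a b
    h-m-a : h m a ≡ f b a
    h-m-a rewrite punchInℕ-≥ (ℕ.≤-pred a<b) | punchInℕ-< {b} a<b = unitColumn-≢ b a f b a≢b
    col-a-of-h : ∀ v → v < suc m → v ≢ m → h v a ≡ + 0
    col-a-of-h v v<b v≢m rewrite punchInℕ-< {b} a<b =
      trans (unitColumn-≢ b a f (punchInℕ a v) a≢b)
            (col-a (punchInℕ a v) (s≤s (ℕ.≤-trans (punchInℕ-≤ a v) v<b)) (punchInℕ-≢ a v)
                   (ℕ.<⇒≢ (below-b (ℕ.≤∧≢⇒< (ℕ.≤-pred v<b) v≢m))))
    minor-h : det m (matrix m (minorℕ h m a)) ≡ D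
    minor-h = det-matrix-cong m (λ v w v<m w<m →
      trans (cong₂ (unitColumn b a f) (cong (punchInℕ a) (punchInℕ-< v<m)) (punchInℕ-< (below-b w<m)))
            (unitColumn-≢ b a f (punchInℕ a v) (ℕ.<⇒≢ (below-b w<m))))

  det-block : det (suc b) (matrix (suc b) f) ≡ (f a a * f b b - f a b * f b a) * D
  det-block = begin
    det (suc b) (matrix (suc b) f)
      ≡⟨ det-linear-columnℕ (suc b) f (unitColumn b a f) (unitColumn b b f) (f a b) (f b b) ℕ.≤-refl split-b
           (λ v u _ _ u≢b → sym (unitColumn-≢ b a f v u≢b)) (λ v u _ _ u≢b → sym (unitColumn-≢ b b f v u≢b)) ⟩
    f a b * det (suc b) (matrix _ (unitColumn b a f)) + f b b * det (suc b) (matrix _ (unitColumn b b f))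
      ≡⟨ cong₂ (λ d₁ d₂ → f a b * d₁ + f b b * d₂) det-unitColumn-off-diagonal det-unitColumn-diagonal ⟩
    f a b * (sgn (a ℕ.+ b) * (sgn (m ℕ.+ a) * (f b a * D))) + f b b * (f a a * D)
      ≡⟨ cong (λ σ → f a b * σ + f b b * (f a a * D)) (sym (ℤ.*-assoc (sgn (a ℕ.+ b)) (sgn (m ℕ.+ a)) (f b a * D))) ⟩
    f a b * ((sgn (a ℕ.+ b) * sgn (m ℕ.+ a)) * (f b a * D)) + f b b * (f a a * D)
      ≡⟨ cong (λ σ → f a b * (σ * (f b a * D)) + f b b * (f a a * D)) signs ⟩
    f a b * (- + 1 * (f b a * D)) + f b b * (f a a * D)
      ≡⟨ ring (f a a) (f a b) (f b a) (f b b) D ⟩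
    (f a a * f b b - f a b * f b a) * D ∎
    where
    open ≡-Reasoning
    split-b : ∀ v → v < suc b → f v b ≡ f a b * unitColumn b a f v b + f b b * unitColumn b b f v b
    split-b v v<n with v ℕ.≟ a | v ℕ.≟ b
    ... | yes refl | _ rewrite unitColumn-diagonal b v f | unitColumn-off b b f a≢b = sym (ring₁ (f v b) (f b b))
      where ring₁ : ∀ x y → x * + 1 + y * + 0 ≡ x
            ring₁ = solve-∀
    ... | no v≢a | yes refl rewrite unitColumn-diagonal v v f | unitColumn-off v a f v≢a = sym (ring₂ (f a v) (f v v))
      where ring₂ : ∀ x y → x * + 0 + y * + 1 ≡ y
            ring₂ = solve-∀
    ... | no v≢a | no v≢b rewrite unitColumn-off b a f v≢a | unitColumn-off b b f v≢b | col-b v v<n v≢a v≢b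
      = sym (ring₃ (f a b) (f b b))
      where ring₃ : ∀ x y → x * + 0 + y * + 0 ≡ + 0
            ring₃ = solve-∀
    signs : sgn (a ℕ.+ b) * sgn (m ℕ.+ a) ≡ - + 1
    signs = begin
      sgn (a ℕ.+ suc m) * sgn (m ℕ.+ a)        ≡⟨ cong₂ (λ x y → sgn x * sgn y) (ℕ.+-suc a m) (ℕ.+-comm m a) ⟩
      sgn (suc (a ℕ.+ m)) * sgn (a ℕ.+ m)      ≡⟨ cong (_* sgn (a ℕ.+ m)) (sgn-suc (a ℕ.+ m)) ⟩
      - sgn (a ℕ.+ m) * sgn (a ℕ.+ m)          ≡⟨ ℤ.neg-distribˡ-* (sgn (a ℕ.+ m)) _ ⟨
      - (sgn (a ℕ.+ m) * sgn (a ℕ.+ m))        ≡⟨ cong -_ (sgn-square (a ℕ.+ m)) ⟩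
      - + 1                                    ∎
    ring : ∀ aa ab ba bb D → ab * (- + 1 * (ba * D)) + bb * (aa * D) ≡ (aa * bb - ab * ba) * D
    ring = solve-∀

det-matrix-resize : ∀ {n n′} (f : ℕ → ℕ → ℤ) → n ≡ n′ → det n (matrix n f) ≡ det n′ (matrix n′ f)
det-matrix-resize f refl = refl

-- The centre, the p star leaves without pendant, and in each of the q branches the star leaf
-- (inner) and the pendant vertex attached to it (outer).
data Vertex : Set where
  centre : Vertex
  leaf inner outer : ℕ → Vertex

IsVertex : ℕ → ℕ → Vertex → Set
IsVertex p q centre    = ⊤
IsVertex p q (leaf i)  = i < p
IsVertex p q (inner j) = j < q
IsVertex p q (outer j) = j < q

_==_ : Vertex → Vertex → Bool
centre  == centre   = true
leaf i  == leaf i′  = i ≡ᵇ i′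
inner j == inner j′ = j ≡ᵇ j′
outer j == outer j′ = j ≡ᵇ j′
_       == _        = false

==-refl : ∀ c → (c == c) ≡ true
==-refl centre    = refl
==-refl (leaf i)  = ≡ᵇ-refl i
==-refl (inner j) = ≡ᵇ-refl j
==-refl (outer j) = ≡ᵇ-refl j

==-≢ : ∀ c c′ → c ≢ c′ → (c == c′) ≡ false
==-≢ centre    centre     c≢c′ = ⊥-elim (c≢c′ refl)
==-≢ (leaf i)  (leaf i′)  c≢c′ = ≡ᵇ-≢ i i′ (λ e → c≢c′ (cong leaf e))
==-≢ (inner j) (inner j′) c≢c′ = ≡ᵇ-≢ j j′ (λ e → c≢c′ (cong inner e))
==-≢ (outer j) (outer j′) c≢c′ = ≡ᵇ-≢ j j′ (λ e → c≢c′ (cong outer e))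
==-≢ centre    (leaf _)   _ = refl
==-≢ centre    (inner _)  _ = refl
==-≢ centre    (outer _)  _ = refl
==-≢ (leaf _)  centre     _ = refl
==-≢ (leaf _)  (inner _)  _ = refl
==-≢ (leaf _)  (outer _)  _ = refl
==-≢ (inner _) centre     _ = refl
==-≢ (inner _) (leaf _)   _ = refl
==-≢ (inner _) (outer _)  _ = refl
==-≢ (outer _) centre     _ = refl
==-≢ (outer _) (leaf _)   _ = refl
==-≢ (outer _) (inner _)  _ = refl

index : ℕ → ℕ → Vertex → ℕ
index p q centre    = 0
index p q (leaf i)  = suc i
index p q (inner j) = suc (p ℕ.+ j)
index p q (outer j) = suc (p ℕ.+ (q ℕ.+ j))

vertexAt : ℕ → ℕ → ℕ → Vertex
vertexAt p q zero    = centre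
vertexAt p q (suc r) =
  if r <ᵇ p then leaf r else if r ∸ p <ᵇ q then inner (r ∸ p) else outer (r ∸ p ∸ q)

order : ℕ → ℕ → ℕ
order p zero    = suc p
order p (suc q) = suc (suc (order p q))

order≡ : ∀ p q → order p q ≡ suc (p ℕ.+ (q ℕ.+ q))
order≡ p zero    = cong suc (sym (ℕ.+-identityʳ p))
order≡ p (suc q) = trans (cong (2 ℕ.+_) (order≡ p q)) (shift p q)
  where
  shift : ∀ p q → 3 ℕ.+ (p ℕ.+ (q ℕ.+ q)) ≡ 1 ℕ.+ (p ℕ.+ ((1 ℕ.+ q) ℕ.+ (1 ℕ.+ q)))
  shift = ℕ-Solver.solve-∀

order-suc : ∀ p q → order (suc p) q ≡ suc (order p q)
order-suc p zero    = refl
order-suc p (suc q) = cong (λ n → suc (suc n)) (order-suc p q)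

vertexAt-index : ∀ p q c → IsVertex p q c → vertexAt p q (index p q c) ≡ c
vertexAt-index p q centre    _   = refl
vertexAt-index p q (leaf i)  i<p rewrite <ᵇ-true i<p = refl
vertexAt-index p q (inner j) j<q
  rewrite <ᵇ-false (ℕ.m+n≮m p j) | ℕ.m+n∸m≡n p j | <ᵇ-true j<q = refl
vertexAt-index p q (outer j) _
  rewrite <ᵇ-false (ℕ.m+n≮m p (q ℕ.+ j)) | ℕ.m+n∸m≡n p (q ℕ.+ j) | <ᵇ-false (ℕ.m+n≮m q j) | ℕ.m+n∸m≡n q j = refl

index<order : ∀ p q c → IsVertex p q c → index p q c < order p q
index<order p q c c∈H = subst (index p q c <_) (sym (order≡ p q)) (bound c c∈H)
  where
  bound : ∀ c → IsVertex p q c → index p q c < suc (p ℕ.+ (q ℕ.+ q))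
  bound centre    _   = s≤s z≤n
  bound (leaf i)  i<p = s≤s (ℕ.≤-trans i<p (ℕ.m≤m+n p (q ℕ.+ q)))
  bound (inner j) j<q = s≤s (ℕ.+-monoʳ-< p (ℕ.≤-trans j<q (ℕ.m≤m+n q q)))
  bound (outer j) j<q = s≤s (ℕ.+-monoʳ-< p (ℕ.+-monoʳ-< q j<q))

index-surjective : ∀ p q v → v < order p q → Σ[ c ∈ Vertex ] IsVertex p q c × index p q c ≡ v
index-surjective p q zero    _   = centre , tt , refl
index-surjective p q (suc r) r<n with r ℕ.<? p
... | yes r<p = leaf r , r<p , refl
... | no  r≮p with ℕ.m≤n⇒∃[o]m+o≡n (ℕ.≮⇒≥ r≮p)
...   | j , p+j≡r with j ℕ.<? q
...     | yes j<q = inner j , j<q , cong suc p+j≡r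
...     | no  j≮q with ℕ.m≤n⇒∃[o]m+o≡n (ℕ.≮⇒≥ j≮q)
...       | j′ , q+j′≡j = outer j′ , j′<q , cong suc p+q+j′≡r
  where
  p+q+j′≡r : p ℕ.+ (q ℕ.+ j′) ≡ r
  p+q+j′≡r = trans (cong (p ℕ.+_) q+j′≡j) p+j≡r
  j′<q : j′ < q
  j′<q = ℕ.+-cancelˡ-< q j′ q (ℕ.+-cancelˡ-< p (q ℕ.+ j′) (q ℕ.+ q)
           (subst (_< p ℕ.+ (q ℕ.+ q)) (sym p+q+j′≡r) (ℕ.≤-pred (subst (suc r <_) (order≡ p q) r<n))))

module _ (p q : ℕ) {v : ℕ} (v<n : v < order p q) where

  index-vertexAt : index p q (vertexAt p q v) ≡ v
  index-vertexAt with index-surjective p q v v<n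
  ... | c , c∈H , refl = cong (index p q) (vertexAt-index p q c c∈H)

  vertexAt-isVertex : IsVertex p q (vertexAt p q v)
  vertexAt-isVertex with index-surjective p q v v<n
  ... | c , c∈H , refl = subst (IsVertex p q) (sym (vertexAt-index p q c c∈H)) c∈H

  vertexAt-≢ : ∀ c → v ≢ index p q c → vertexAt p q v ≢ c
  vertexAt-≢ c v≢c refl = v≢c (sym index-vertexAt)

≡ᵇ-vertexAt : ∀ p q {v w} → v < order p q → w < order p q → (v ≡ᵇ w) ≡ (vertexAt p q v == vertexAt p q w)
≡ᵇ-vertexAt p q {v} {w} v<n w<n with v ℕ.≟ w
... | yes refl = trans (≡ᵇ-refl v) (sym (==-refl (vertexAt p q v)))
... | no  v≢w  = trans (≡ᵇ-≢ v w v≢w) (sym (==-≢ _ _ (λ eq → v≢w (trans (sym (index-vertexAt p q v<n))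
                                                        (trans (cong (index p q) eq) (index-vertexAt p q w<n))))))

-- Position 1 + p + q of H_{p,q+1} is its last inner vertex; its pendant is the last position.
vertexAt-skipLastInner : ∀ p q {v} → v < order p q → vertexAt p (suc q) (punchInℕ (suc (p ℕ.+ q)) v) ≡ vertexAt p q v
vertexAt-skipLastInner p q v<n with index-surjective p q _ v<n
... | centre    , _    , refl = refl
... | leaf i    , i<p  , refl =
  trans (cong (vertexAt p (suc q)) (punchInℕ-< (s≤s (ℕ.≤-trans i<p (ℕ.m≤m+n p q)))))
        (trans (vertexAt-index p (suc q) (leaf i) i<p) (sym (vertexAt-index p q (leaf i) i<p)))
... | inner j   , j<q  , refl =
  trans (cong (vertexAt p (suc q)) (punchInℕ-< (s≤s (ℕ.+-monoʳ-< p j<q))))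
        (trans (vertexAt-index p (suc q) (inner j) (ℕ.m≤n⇒m≤1+n j<q)) (sym (vertexAt-index p q (inner j) j<q)))
... | outer j   , j<q  , refl =
  trans (cong (vertexAt p (suc q)) (trans (punchInℕ-≥ (s≤s (ℕ.+-monoʳ-≤ p (ℕ.m≤m+n q j))))
                                           (cong suc (sym (ℕ.+-suc p (q ℕ.+ j))))))
        (trans (vertexAt-index p (suc q) (outer j) (ℕ.m≤n⇒m≤1+n j<q)) (sym (vertexAt-index p q (outer j) j<q)))

vertexAt-skipLastLeaf : ∀ p q {v} → v < order p q → vertexAt (suc p) q (punchInℕ (suc p) v) ≡ vertexAt p q v
vertexAt-skipLastLeaf p q v<n with index-surjective p q _ v<n
... | centre    , _    , refl = refl
... | leaf i    , i<p  , refl =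
  trans (cong (vertexAt (suc p) q) (punchInℕ-< (s≤s i<p)))
        (trans (vertexAt-index (suc p) q (leaf i) (ℕ.m≤n⇒m≤1+n i<p)) (sym (vertexAt-index p q (leaf i) i<p)))
... | inner j   , j<q  , refl =
  trans (cong (vertexAt (suc p) q) (punchInℕ-≥ (s≤s (ℕ.m≤m+n p j))))
        (trans (vertexAt-index (suc p) q (inner j) j<q) (sym (vertexAt-index p q (inner j) j<q)))
... | outer j   , j<q  , refl =
  trans (cong (vertexAt (suc p) q) (punchInℕ-≥ (s≤s (ℕ.m≤m+n p (q ℕ.+ j)))))
        (trans (vertexAt-index (suc p) q (outer j) j<q) (sym (vertexAt-index p q (outer j) j<q)))

-- Graph distance

module _ {A : Set} where

  any-true : ∀ {n} (f : A → Bool) (g : Fin n → A) w → f (g w) ≡ true → any f (tabulate g) ≡ true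
  any-true f g zero    fw rewrite fw = refl
  any-true f g (suc w) fw = trans (cong (f (g zero) ∨_) (any-true f (λ i → g (suc i)) w fw)) (∨-zeroʳ (f (g zero)))

  any-false : ∀ n (f : A → Bool) (g : Fin n → A) → (∀ w → f (g w) ≡ false) → any f (tabulate g) ≡ false
  any-false zero    f g _  = refl
  any-false (suc n) f g f≡false rewrite f≡false zero = any-false n f (λ i → g (suc i)) (λ w → f≡false (suc w))

  any-cong : ∀ n {f f′ : A → Bool} (g : Fin n → A) → (∀ w → f (g w) ≡ f′ (g w)) → any f (tabulate g) ≡ any f′ (tabulate g)
  any-cong zero    g _    = refl
  any-cong (suc n) g f≡f′ = cong₂ _∨_ (f≡f′ zero) (any-cong n (λ i → g (suc i)) (λ w → f≡f′ (suc w)))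

  max-≤ : ∀ n (f : A → ℕ) (g : Fin n → A) {m} → (∀ w → f (g w) ≤ m) → foldr _⊔_ 0 (map f (tabulate g)) ≤ m
  max-≤ zero    f g _   = z≤n
  max-≤ (suc n) f g f≤m = ℕ.⊔-lub (f≤m zero) (max-≤ n f (λ i → g (suc i)) (λ w → f≤m (suc w)))

  ≤-max : ∀ n (f : A → ℕ) (g : Fin n → A) w → f (g w) ≤ foldr _⊔_ 0 (map f (tabulate g))
  ≤-max (suc n) f g zero    = ℕ.m≤m⊔n (f (g zero)) _
  ≤-max (suc n) f g (suc w) = ℕ.≤-trans (≤-max n f (λ i → g (suc i)) w) (ℕ.m≤n⊔m (f (g zero)) _)

module _ {n : ℕ} (G : Graph n) (D : Fin n → Fin n → ℕ)
  (D-zero : ∀ u v → ⌊ u ≟ v ⌋ ≡ (D u v ≤ᵇ 0))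
  (D-edge : ∀ u w v → G u w ≡ true → D u v ≤ suc (D w v))
  (D-step : ∀ u v → 1 ≤ D u v → Σ[ w ∈ Fin n ] G u w ≡ true × suc (D w v) ≡ D u v) where

  reach≡≤ᵇ : ∀ k u v → reach G k u v ≡ (D u v ≤ᵇ k)
  reach≡≤ᵇ zero    u v = D-zero u v
  reach≡≤ᵇ (suc k) u v =
    trans (cong₂ _∨_ (reach≡≤ᵇ k u v) (any-cong n id (λ w → cong (G u w ∧_) (reach≡≤ᵇ k w v))))
          (step (D u v ≤ᵇ k) refl)
    where
    neighbour-within : Bool
    neighbour-within = any (λ w → G u w ∧ (D w v ≤ᵇ k)) (allFin n)
    step : ∀ b → (D u v ≤ᵇ k) ≡ b → (b ∨ neighbour-within) ≡ (D u v ≤ᵇ suc k)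
    step true  D≤k = sym (≤ᵇ-true (ℕ.m≤n⇒m≤1+n (≤ᵇ-sound {D u v} {k} D≤k)))
    step false D≰k with D u v ℕ.≟ suc k
    ... | yes D≡1+k with D-step u v (subst (1 ≤_) (sym D≡1+k) (s≤s z≤n))
    ...   | w , uw , D-drops =
      trans (any-true _ id w (cong₂ _∧_ uw (≤ᵇ-true (ℕ.≤-reflexive (ℕ.suc-injective (trans D-drops D≡1+k))))))
            (sym (≤ᵇ-true (ℕ.≤-reflexive D≡1+k)))
    step false D≰k | no D≢1+k = trans (any-false n _ id too-far) (sym (≤ᵇ-false 1+k<D))
      where
      1+k<D : suc k < D u v
      1+k<D = ℕ.≤∧≢⇒< (ℕ.≰⇒> (λ D≤k → subst T D≰k (ℕ.≤⇒≤ᵇ D≤k))) (D≢1+k ∘ sym)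
      too-far : ∀ w → (G u w ∧ (D w v ≤ᵇ k)) ≡ false
      too-far w with G u w in uw
      ... | false = refl
      ... | true  = ≤ᵇ-false (ℕ.≤-pred (ℕ.≤-trans 1+k<D (D-edge u w v uw)))

-- The search inside dist is local to its definition, so it is unfolded step by step for the
-- distances up to 4 that occur here.
dist-≤4 : ∀ {n} m → n ≡ 5 ℕ.+ m → (G : Graph n) → ∀ u v d → d ≤ 4 → (∀ k → reach G k u v ≡ (d ≤ᵇ k)) →
          dist G u v ≡ d
dist-≤4 m refl G u v 0 _ reach≡ = if-cong (reach≡ 0)
dist-≤4 m refl G u v 1 _ reach≡ = trans (if-cong (reach≡ 0)) (if-cong (reach≡ 1))
dist-≤4 m refl G u v 2 _ reach≡ = trans (if-cong (reach≡ 0)) (trans (if-cong (reach≡ 1)) (if-cong (reach≡ 2)))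
dist-≤4 m refl G u v 3 _ reach≡ =
  trans (if-cong (reach≡ 0)) (trans (if-cong (reach≡ 1)) (trans (if-cong (reach≡ 2)) (if-cong (reach≡ 3))))
dist-≤4 m refl G u v 4 _ reach≡ =
  trans (if-cong (reach≡ 0)) (trans (if-cong (reach≡ 1)) (trans (if-cong (reach≡ 2))
    (trans (if-cong (reach≡ 3)) (if-cong (reach≡ 4)))))
dist-≤4 m refl G u v (suc (suc (suc (suc (suc _))))) (s≤s (s≤s (s≤s (s≤s ())))) _

ecc-≡ : ∀ {n} (G : Graph n) u {e} → (∀ v → dist G u v ≤ e) → Σ[ v ∈ Fin n ] dist G u v ≡ e → ecc G u ≡ e
ecc-≡ {n} G u bound (v , dist≡e) =
  ℕ.≤-antisym (max-≤ n (dist G u) id bound) (subst (_≤ ecc G u) dist≡e (≤-max n (dist G u) id v))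

adjacent : Vertex → Vertex → Bool
adjacent centre    (leaf _)   = true
adjacent centre    (inner _)  = true
adjacent (leaf _)  centre     = true
adjacent (inner _) centre     = true
adjacent (inner j) (outer j′) = j ≡ᵇ j′
adjacent (outer j) (inner j′) = j ≡ᵇ j′
adjacent _         _          = false

distance : Vertex → Vertex → ℕ
distance centre    centre     = 0
distance centre    (leaf _)   = 1
distance centre    (inner _)  = 1
distance centre    (outer _)  = 2
distance (leaf _)  centre     = 1
distance (leaf i)  (leaf i′)  = if i ≡ᵇ i′ then 0 else 2
distance (leaf _)  (inner _)  = 2
distance (leaf _)  (outer _)  = 3
distance (inner _) centre     = 1
distance (inner _) (leaf _)   = 2
distance (inner j) (inner j′) = if j ≡ᵇ j′ then 0 else 2
distance (inner j) (outer j′) = if j ≡ᵇ j′ then 1 else 3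
distance (outer _) centre     = 2
distance (outer _) (leaf _)   = 3
distance (outer j) (inner j′) = if j ≡ᵇ j′ then 1 else 3
distance (outer j) (outer j′) = if j ≡ᵇ j′ then 0 else 4

eccentricity : Vertex → ℕ
eccentricity centre    = 2
eccentricity (leaf _)  = 3
eccentricity (inner _) = 3
eccentricity (outer _) = 4

eccentricityEntry : Vertex → Vertex → ℤ
eccentricityEntry c c′ = if distance c c′ ≡ᵇ eccentricity c ⊓ eccentricity c′ then + distance c c′ else + 0

private
  ≤! : ∀ {m n} {_ : T (m ≤ᵇ n)} → m ≤ n
  ≤! {m} {n} {m≤n} = ℕ.≤ᵇ⇒≤ m n m≤n

  if-≤ : ∀ b {x y m} → x ≤ m → y ≤ m → (if b then x else y) ≤ m
  if-≤ true  x≤m _   = x≤m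
  if-≤ false _   y≤m = y≤m

  ≤-if : ∀ b {x y m} → m ≤ x → m ≤ y → m ≤ (if b then x else y)
  ≤-if true  m≤x _   = m≤x
  ≤-if false _   m≤y = m≤y

  if-≤-suc : ∀ b {x y x′ y′} → x ≤ suc x′ → y ≤ suc y′ → (if b then x else y) ≤ suc (if b then x′ else y′)
  if-≤-suc true  x≤x′ _    = x≤x′
  if-≤-suc false _    y≤y′ = y≤y′

  if-zero : ∀ b {x} → ((if b then 0 else suc x) ≤ᵇ 0) ≡ b
  if-zero true  = refl
  if-zero false = refl

  if-suc : ∀ b {x y} → ((if b then suc x else suc y) ≤ᵇ 0) ≡ false
  if-suc true  = refl
  if-suc false = refl

distance-zero : ∀ c c′ → (distance c c′ ≤ᵇ 0) ≡ (c == c′)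
distance-zero centre    centre     = refl
distance-zero centre    (leaf _)   = refl
distance-zero centre    (inner _)  = refl
distance-zero centre    (outer _)  = refl
distance-zero (leaf _)  centre     = refl
distance-zero (leaf i)  (leaf i′)  = if-zero (i ≡ᵇ i′)
distance-zero (leaf _)  (inner _)  = refl
distance-zero (leaf _)  (outer _)  = refl
distance-zero (inner _) centre     = refl
distance-zero (inner _) (leaf _)   = refl
distance-zero (inner j) (inner j′) = if-zero (j ≡ᵇ j′)
distance-zero (inner j) (outer j′) = if-suc (j ≡ᵇ j′)
distance-zero (outer _) centre     = refl
distance-zero (outer _) (leaf _)   = refl
distance-zero (outer j) (inner j′) = if-suc (j ≡ᵇ j′)
distance-zero (outer j) (outer j′) = if-zero (j ≡ᵇ j′)

distance≤eccentricity : ∀ c c′ → distance c c′ ≤ eccentricity c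
distance≤eccentricity centre    centre     = ≤!
distance≤eccentricity centre    (leaf _)   = ≤!
distance≤eccentricity centre    (inner _)  = ≤!
distance≤eccentricity centre    (outer _)  = ≤!
distance≤eccentricity (leaf _)  centre     = ≤!
distance≤eccentricity (leaf i)  (leaf i′)  = if-≤ (i ≡ᵇ i′) ≤! ≤!
distance≤eccentricity (leaf _)  (inner _)  = ≤!
distance≤eccentricity (leaf _)  (outer _)  = ≤!
distance≤eccentricity (inner _) centre     = ≤!
distance≤eccentricity (inner _) (leaf _)   = ≤!
distance≤eccentricity (inner j) (inner j′) = if-≤ (j ≡ᵇ j′) ≤! ≤!
distance≤eccentricity (inner j) (outer j′) = if-≤ (j ≡ᵇ j′) ≤! ≤!
distance≤eccentricity (outer _) centre     = ≤!
distance≤eccentricity (outer _) (leaf _)   = ≤!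
distance≤eccentricity (outer j) (inner j′) = if-≤ (j ≡ᵇ j′) ≤! ≤!
distance≤eccentricity (outer j) (outer j′) = if-≤ (j ≡ᵇ j′) ≤! ≤!

eccentricity≤4 : ∀ c → eccentricity c ≤ 4
eccentricity≤4 centre    = ≤!
eccentricity≤4 (leaf _)  = ≤!
eccentricity≤4 (inner _) = ≤!
eccentricity≤4 (outer _) = ≤!

distance-edge : ∀ c c′ c″ → adjacent c c′ ≡ true → distance c c″ ≤ suc (distance c′ c″)
distance-edge centre (leaf _)  centre     _ = ≤!
distance-edge centre (leaf _)  (leaf _)   _ = s≤s z≤n
distance-edge centre (leaf _)  (inner _)  _ = ≤!
distance-edge centre (leaf _)  (outer _)  _ = ≤!
distance-edge centre (inner _) centre     _ = ≤!
distance-edge centre (inner _) (leaf _)   _ = ≤!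
distance-edge centre (inner j) (inner j″) _ = s≤s z≤n
distance-edge centre (inner j) (outer j″) _ = s≤s (≤-if (j ≡ᵇ j″) ≤! ≤!)
distance-edge (leaf _)  centre centre     _ = ≤!
distance-edge (leaf i)  centre (leaf i″)  _ = if-≤ (i ≡ᵇ i″) ≤! ≤!
distance-edge (leaf _)  centre (inner _)  _ = ≤!
distance-edge (leaf _)  centre (outer _)  _ = ≤!
distance-edge (inner _) centre centre     _ = ≤!
distance-edge (inner _) centre (leaf _)   _ = ≤!
distance-edge (inner j) centre (inner j″) _ = if-≤ (j ≡ᵇ j″) ≤! ≤!
distance-edge (inner j) centre (outer j″) _ = if-≤ (j ≡ᵇ j″) ≤! ≤!
distance-edge (inner j) (outer j′) c″ jj′ with ℕ.≡ᵇ⇒≡ j j′ (subst T (sym jj′) tt)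
... | refl = along c″
  where
  along : ∀ c″ → distance (inner j) c″ ≤ suc (distance (outer j) c″)
  along centre     = ≤!
  along (leaf _)   = ≤!
  along (inner j″) = if-≤-suc (j ≡ᵇ j″) ≤! ≤!
  along (outer j″) = if-≤-suc (j ≡ᵇ j″) ≤! ≤!
distance-edge (outer j) (inner j′) c″ jj′ with ℕ.≡ᵇ⇒≡ j j′ (subst T (sym jj′) tt)
... | refl = along c″
  where
  along : ∀ c″ → distance (outer j) c″ ≤ suc (distance (inner j) c″)
  along centre     = ≤!
  along (leaf _)   = ≤!
  along (inner j″) = if-≤-suc (j ≡ᵇ j″) ≤! ≤!
  along (outer j″) = if-≤-suc (j ≡ᵇ j″) ≤! ≤!

module _ (p q : ℕ) where

  Step : Vertex → Vertex → Set
  Step c c″ = Σ[ c′ ∈ Vertex ] IsVertex p q c′ × adjacent c c′ ≡ true × suc (distance c′ c″) ≡ distance c c″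

  distance-step : ∀ c c″ → IsVertex p q c → IsVertex p q c″ → 1 ≤ distance c c″ → Step c c″
  distance-step centre    centre     _ _ ()
  distance-step centre    (leaf i)   _ i<p _ = leaf i , i<p , refl , cong (λ b → suc (if b then 0 else 2)) (≡ᵇ-refl i)
  distance-step centre    (inner j)  _ j<q _ = inner j , j<q , refl , cong (λ b → suc (if b then 0 else 2)) (≡ᵇ-refl j)
  distance-step centre    (outer j)  _ j<q _ = inner j , j<q , refl , cong (λ b → suc (if b then 1 else 3)) (≡ᵇ-refl j)
  distance-step (leaf _)  centre     _ _ _ = centre , tt , refl , refl
  distance-step (leaf i)  (leaf i″)  _ _ 1≤d with i ≡ᵇ i″
  ... | true  = ⊥-elim (ℕ.<-irrefl refl 1≤d)
  ... | false = centre , tt , refl , refl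
  distance-step (leaf _)  (inner _)  _ _ _ = centre , tt , refl , refl
  distance-step (leaf _)  (outer _)  _ _ _ = centre , tt , refl , refl
  distance-step (inner _) centre     _ _ _ = centre , tt , refl , refl
  distance-step (inner _) (leaf _)   _ _ _ = centre , tt , refl , refl
  distance-step (inner j) (inner j″) _ _ 1≤d with j ≡ᵇ j″
  ... | true  = ⊥-elim (ℕ.<-irrefl refl 1≤d)
  ... | false = centre , tt , refl , refl
  distance-step (inner j) (outer j″) j<q _ _ with j ℕ.≟ j″
  ... | yes refl = outer j , j<q , ≡ᵇ-refl j ,
                   trans (cong (λ b → suc (if b then 0 else 4)) (≡ᵇ-refl j)) (cong (λ b → if b then 1 else 3) (sym (≡ᵇ-refl j)))
  ... | no  j≢j″ = centre , tt , refl , cong (λ b → if b then 1 else 3) (sym (≡ᵇ-≢ j j″ j≢j″))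
  distance-step (outer j) c″ j<q _ 1≤d = inner j , j<q , ≡ᵇ-refl j , towards c″ 1≤d
    where
    towards : ∀ c″ → 1 ≤ distance (outer j) c″ → suc (distance (inner j) c″) ≡ distance (outer j) c″
    towards centre     _ = refl
    towards (leaf _)   _ = refl
    towards (inner j″) _ with j ≡ᵇ j″
    ... | true  = refl
    ... | false = refl
    towards (outer j″) 1≤d with j ≡ᵇ j″
    ... | true  = ⊥-elim (ℕ.<-irrefl refl 1≤d)
    ... | false = refl

  eccentricity-attained : 2 ≤ q → ∀ c → Σ[ c″ ∈ Vertex ] IsVertex p q c″ × distance c c″ ≡ eccentricity c
  eccentricity-attained 2≤q centre    = outer 0 , ℕ.≤-trans (s≤s z≤n) 2≤q , refl
  eccentricity-attained 2≤q (leaf _)  = outer 0 , ℕ.≤-trans (s≤s z≤n) 2≤q , refl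
  eccentricity-attained 2≤q (inner j) with j ℕ.≟ 0
  ... | yes refl = outer 1 , 2≤q , refl
  ... | no  j≢0  = outer 0 , ℕ.≤-trans (s≤s z≤n) 2≤q , cong (λ b → if b then 1 else 3) (≡ᵇ-≢ j 0 j≢0)
  eccentricity-attained 2≤q (outer j) with j ℕ.≟ 0
  ... | yes refl = outer 1 , 2≤q , refl
  ... | no  j≢0  = outer 0 , ℕ.≤-trans (s≤s z≤n) 2≤q , cong (λ b → if b then 0 else 4) (≡ᵇ-≢ j 0 j≢0)

parentOf : Vertex → Vertex → Bool
parentOf centre    (leaf _)   = true
parentOf centre    (inner _)  = true
parentOf (inner j) (outer j′) = j ≡ᵇ j′
parentOf _         _          = false

adjacent≡parentOf : ∀ c c′ → adjacent c c′ ≡ (parentOf c c′ ∨ parentOf c′ c)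
adjacent≡parentOf centre    centre     = refl
adjacent≡parentOf centre    (leaf _)   = refl
adjacent≡parentOf centre    (inner _)  = refl
adjacent≡parentOf centre    (outer _)  = refl
adjacent≡parentOf (leaf _)  centre     = refl
adjacent≡parentOf (leaf _)  (leaf _)   = refl
adjacent≡parentOf (leaf _)  (inner _)  = refl
adjacent≡parentOf (leaf _)  (outer _)  = refl
adjacent≡parentOf (inner _) centre     = refl
adjacent≡parentOf (inner _) (leaf _)   = refl
adjacent≡parentOf (inner _) (inner _)  = refl
adjacent≡parentOf (inner j) (outer j′) = sym (∨-identityʳ (j ≡ᵇ j′))
adjacent≡parentOf (outer _) centre     = refl
adjacent≡parentOf (outer _) (leaf _)   = refl
adjacent≡parentOf (outer j) (inner j′) = ≡ᵇ-sym j j′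
adjacent≡parentOf (outer _) (outer _)  = refl

module _ (p q : ℕ) where

  private
    1+p≤ : ∀ {m} → p ≤ m → (p ℕ.+ 1 ≤ᵇ suc m) ≡ true
    1+p≤ {m} p≤m = ≤ᵇ-true (subst (_≤ suc m) (ℕ.+-comm 1 p) (s≤s p≤m))

    1+p≰ : ∀ {m} → m ≤ p → (p ℕ.+ 1 ≤ᵇ m) ≡ false
    1+p≰ {m} m≤p = ≤ᵇ-false (subst (m <_) (ℕ.+-comm 1 p) (s≤s m≤p))

    leaf≤ : ∀ {i} → i < p → (suc i ≤ᵇ p ℕ.+ q) ≡ true
    leaf≤ i<p = ≤ᵇ-true (ℕ.≤-trans i<p (ℕ.m≤m+n p q))

    inner≤ : ∀ {j} → j < q → (suc (p ℕ.+ j) ≤ᵇ p ℕ.+ q) ≡ true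
    inner≤ j<q = ≤ᵇ-true (ℕ.+-monoʳ-< p j<q)

    outer≰ : ∀ j → (suc (p ℕ.+ (q ℕ.+ j)) ≤ᵇ p ℕ.+ q) ≡ false
    outer≰ j = ≤ᵇ-false (s≤s (ℕ.+-monoʳ-≤ p (ℕ.m≤m+n q j)))

    outer-index : ∀ j j′ → (p ℕ.+ (q ℕ.+ j′) ≡ᵇ p ℕ.+ j ℕ.+ q) ≡ (j ≡ᵇ j′)
    outer-index j j′ = begin
      (p ℕ.+ (q ℕ.+ j′) ≡ᵇ p ℕ.+ j ℕ.+ q)
        ≡⟨ cong (_≡ᵇ_ (p ℕ.+ (q ℕ.+ j′))) (trans (ℕ.+-assoc p j q) (cong (p ℕ.+_) (ℕ.+-comm j q))) ⟩
      (p ℕ.+ (q ℕ.+ j′) ≡ᵇ p ℕ.+ (q ℕ.+ j))  ≡⟨ ≡ᵇ-+ˡ p (q ℕ.+ j′) (q ℕ.+ j) ⟩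
      (q ℕ.+ j′ ≡ᵇ q ℕ.+ j)                 ≡⟨ ≡ᵇ-+ˡ q j′ j ⟩
      (j′ ≡ᵇ j)                             ≡⟨ ≡ᵇ-sym j′ j ⟩
      (j ≡ᵇ j′)                             ∎
      where open ≡-Reasoning

  Hadj-index : ∀ c c′ → IsVertex p q c → IsVertex p q c′ → Hadj p q (index p q c) (index p q c′) ≡ parentOf c c′
  Hadj-index centre    centre     _   _   rewrite 1+p≰ {0} z≤n = refl
  Hadj-index centre    (leaf i)   _   i<p rewrite 1+p≰ {0} z≤n | leaf≤ i<p = refl
  Hadj-index centre    (inner j)  _   j<q rewrite 1+p≰ {0} z≤n | inner≤ j<q = refl
  Hadj-index centre    (outer j)  _   _   rewrite 1+p≰ {0} z≤n | outer≰ j = refl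
  Hadj-index (leaf i)  c′         i<p _   rewrite 1+p≰ i<p = refl
  Hadj-index (outer j) c′         _   _   rewrite 1+p≤ (ℕ.m≤m+n p (q ℕ.+ j)) | outer≰ j = refl
  Hadj-index (inner j) c′         j<q c′∈H rewrite 1+p≤ (ℕ.m≤m+n p j) | inner≤ j<q = child c′ c′∈H
    where
    child : ∀ c′ → IsVertex p q c′ → (index p q c′ ≡ᵇ suc (p ℕ.+ j) ℕ.+ q) ≡ parentOf (inner j) c′
    child centre     _    = refl
    child (leaf i)   i<p  = ≡ᵇ-≢ i (p ℕ.+ j ℕ.+ q) (ℕ.<⇒≢ (ℕ.≤-trans i<p (ℕ.≤-trans (ℕ.m≤m+n p j) (ℕ.m≤m+n (p ℕ.+ j) q))))
    child (inner j′) j′<q = ≡ᵇ-≢ (p ℕ.+ j′) (p ℕ.+ j ℕ.+ q)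
      (ℕ.<⇒≢ (ℕ.≤-trans (ℕ.+-monoʳ-< p j′<q) (subst (p ℕ.+ q ≤_) (sym (trans (ℕ.+-assoc p j q) (cong (p ℕ.+_) (ℕ.+-comm j q))))
                                                  (ℕ.+-monoʳ-≤ p (ℕ.m≤m+n q j)))))
    child (outer j′) _    = outer-index j j′

module _ (p q : ℕ) where

  private
    size = p ℕ.+ 2 ℕ.* q ℕ.+ 1

  order≡size : order p q ≡ size
  order≡size = trans (order≡ p q) (arith p q)
    where
    arith : ∀ p q → suc (p ℕ.+ (q ℕ.+ q)) ≡ p ℕ.+ 2 ℕ.* q ℕ.+ 1
    arith = ℕ-Solver.solve-∀

  vertexOf : Fin size → Vertex
  vertexOf u = vertexAt p q (toℕ u)

  toℕ<order : (u : Fin size) → toℕ u < order p q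
  toℕ<order u = subst (toℕ u <_) (sym order≡size) (toℕ<n u)

  vertexOf-isVertex : ∀ u → IsVertex p q (vertexOf u)
  vertexOf-isVertex u = vertexAt-isVertex p q (toℕ<order u)

  vertexOf-surjective : ∀ c → IsVertex p q c → Σ[ u ∈ Fin size ] vertexOf u ≡ c
  vertexOf-surjective c c∈H = fromℕ< index<size , trans (cong (vertexAt p q) (toℕ-fromℕ< index<size)) (vertexAt-index p q c c∈H)
    where
    index<size : index p q c < size
    index<size = subst (index p q c <_) order≡size (index<order p q c c∈H)

  ⌊≟⌋-vertexOf : ∀ u v → ⌊ u ≟ v ⌋ ≡ (vertexOf u == vertexOf v)
  ⌊≟⌋-vertexOf u v with u ≟ v
  ... | yes refl = sym (==-refl (vertexOf u))
  ... | no  u≢v  = sym (trans (sym (≡ᵇ-vertexAt p q (toℕ<order u) (toℕ<order v))) (≡ᵇ-≢ _ _ (u≢v ∘ toℕ-injective)))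

  H-adjacent : ∀ u w → H p q u w ≡ adjacent (vertexOf u) (vertexOf w)
  H-adjacent u w = trans (cong₂ _∨_ (Hadj-vertexOf u w) (Hadj-vertexOf w u)) (sym (adjacent≡parentOf (vertexOf u) (vertexOf w)))
    where
    Hadj-vertexOf : ∀ u w → Hadj p q (toℕ u) (toℕ w) ≡ parentOf (vertexOf u) (vertexOf w)
    Hadj-vertexOf u w = trans (sym (cong₂ (Hadj p q) (index-vertexAt p q (toℕ<order u)) (index-vertexAt p q (toℕ<order w))))
                              (Hadj-index p q (vertexOf u) (vertexOf w) (vertexOf-isVertex u) (vertexOf-isVertex w))

  reach-H : ∀ k u v → reach (H p q) k u v ≡ (distance (vertexOf u) (vertexOf v) ≤ᵇ k)
  reach-H = reach≡≤ᵇ (H p q) (λ u v → distance (vertexOf u) (vertexOf v))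
    (λ u v → trans (⌊≟⌋-vertexOf u v) (sym (distance-zero (vertexOf u) (vertexOf v))))
    (λ u w v uw → distance-edge (vertexOf u) (vertexOf w) (vertexOf v) (trans (sym (H-adjacent u w)) uw))
    step
    where
    step : ∀ u v → 1 ≤ distance (vertexOf u) (vertexOf v) →
           Σ[ w ∈ Fin size ] H p q u w ≡ true × suc (distance (vertexOf w) (vertexOf v)) ≡ distance (vertexOf u) (vertexOf v)
    step u v 1≤d with distance-step p q (vertexOf u) (vertexOf v) (vertexOf-isVertex u) (vertexOf-isVertex v) 1≤d
    ... | c , c∈H , uc , drop with vertexOf-surjective c c∈H
    ...   | w , refl = w , trans (H-adjacent u w) uc , drop

  module _ (2≤q : 2 ≤ q) where

    private
      at-least-5 : ∀ {q} → 2 ≤ q → Σ[ m ∈ ℕ ] p ℕ.+ 2 ℕ.* q ℕ.+ 1 ≡ 5 ℕ.+ m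
      at-least-5 (s≤s (s≤s {n = q′} _)) = p ℕ.+ (q′ ℕ.+ q′) , arith p q′
        where
        arith : ∀ p q′ → p ℕ.+ 2 ℕ.* (2 ℕ.+ q′) ℕ.+ 1 ≡ 5 ℕ.+ (p ℕ.+ (q′ ℕ.+ q′))
        arith = ℕ-Solver.solve-∀

      size≡5+m : Σ[ m ∈ ℕ ] size ≡ 5 ℕ.+ m
      size≡5+m = at-least-5 2≤q

    dist-H : ∀ u v → dist (H p q) u v ≡ distance (vertexOf u) (vertexOf v)
    dist-H u v = dist-≤4 (proj₁ size≡5+m) (proj₂ size≡5+m) (H p q) u v _
      (ℕ.≤-trans (distance≤eccentricity (vertexOf u) (vertexOf v)) (eccentricity≤4 (vertexOf u))) (λ k → reach-H k u v)

    ecc-H : ∀ u → ecc (H p q) u ≡ eccentricity (vertexOf u)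
    ecc-H u with eccentricity-attained p q 2≤q (vertexOf u)
    ... | c , c∈H , d≡e with vertexOf-surjective c c∈H
    ...   | v , refl = ecc-≡ (H p q) u (λ v → subst (_≤ eccentricity (vertexOf u)) (sym (dist-H u v)) (distance≤eccentricity _ _))
                                      (v , trans (dist-H u v) d≡e)

    eccMatrix-H : ∀ u v → eccMatrix (H p q) u v ≡ eccentricityEntry (vertexOf u) (vertexOf v)
    eccMatrix-H u v = cong₂ (λ d e → if d ≡ᵇ e then + d else + 0) (dist-H u v) (cong₂ _⊓_ (ecc-H u) (ecc-H v))

-- Twin elimination

branchEntry : ℕ → ℤ → ℕ → ℕ → ℤ
branchEntry q t j j′ = if j ≡ᵇ pred q then (if j ≡ᵇ j′ then - (+ 3 * (t - + 1)) else - (+ 3 * t))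
                                 else (if j ≡ᵇ j′ then + 0 else - + 3)

-- x I - ε(H_{p,q}) is reduced p q (+ 3) (+ 1) x.  Merging twins keeps this shape: the last leaf
-- then stands for w / 3 leaves and the last branch (inner, outer) for t branches.
reduced : ℕ → ℕ → ℤ → ℤ → ℤ → Vertex → Vertex → ℤ
reduced p q w t x centre    centre     = x
reduced p q w t x centre    (leaf _)   = + 0
reduced p q w t x centre    (inner _)  = + 0
reduced p q w t x centre    (outer _)  = - + 2
reduced p q w t x (leaf _)  centre     = + 0
reduced p q w t x (leaf i)  (leaf i′)  = if i ≡ᵇ i′ then x else + 0
reduced p q w t x (leaf _)  (inner _)  = + 0
reduced p q w t x (leaf i)  (outer _)  = if i ≡ᵇ pred p then - w else - + 3
reduced p q w t x (inner _) centre     = + 0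
reduced p q w t x (inner _) (leaf _)   = + 0
reduced p q w t x (inner j) (inner j′) = if j ≡ᵇ j′ then x else + 0
reduced p q w t x (inner j) (outer j′) = branchEntry q t j j′
reduced p q w t x (outer j) centre     = if j ≡ᵇ pred q then - (+ 2 * t) else - + 2
reduced p q w t x (outer j) (leaf _)   = if j ≡ᵇ pred q then - (+ 3 * t) else - + 3
reduced p q w t x (outer j) (inner j′) = branchEntry q t j j′
reduced p q w t x (outer j) (outer j′) =
  if j ≡ᵇ pred q then (if j ≡ᵇ j′ then x - + 4 * (t - + 1) else - (+ 4 * t))
                 else (if j ≡ᵇ j′ then x else - + 4)

VertexMatrix : Set
VertexMatrix = Vertex → Vertex → ℤ

atIndices : ℕ → ℕ → VertexMatrix → ℕ → ℕ → ℤ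
atIndices p q E v u = E (vertexAt p q v) (vertexAt p q u)

addRow : Vertex → Vertex → ℤ → VertexMatrix → VertexMatrix
addRow κ κ′ c E c₁ c₂ = if c₁ == κ then E c₁ c₂ + c * E κ′ c₂ else E c₁ c₂

addColumn : Vertex → Vertex → ℤ → VertexMatrix → VertexMatrix
addColumn κ κ′ c E c₁ c₂ = if c₂ == κ then E c₁ c₂ + c * E c₁ κ′ else E c₁ c₂

module _ (κ κ′ : Vertex) (c : ℤ) (E : VertexMatrix) (c₁ c₂ : Vertex) where

  addRow-on : (c₁ == κ) ≡ true → addRow κ κ′ c E c₁ c₂ ≡ E c₁ c₂ + c * E κ′ c₂
  addRow-on eq rewrite eq = refl

  addRow-off : (c₁ == κ) ≡ false → addRow κ κ′ c E c₁ c₂ ≡ E c₁ c₂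
  addRow-off eq rewrite eq = refl

  addColumn-on : (c₂ == κ) ≡ true → addColumn κ κ′ c E c₁ c₂ ≡ E c₁ c₂ + c * E c₁ κ′
  addColumn-on eq rewrite eq = refl

  addColumn-off : (c₂ == κ) ≡ false → addColumn κ κ′ c E c₁ c₂ ≡ E c₁ c₂
  addColumn-off eq rewrite eq = refl

module _ (p q : ℕ) (E : VertexMatrix) (κ κ′ : Vertex) (c : ℤ) (κ∈H : IsVertex p q κ) (κ′∈H : IsVertex p q κ′)
         (adj : index p q κ′ ≡ suc (index p q κ) ⊎ index p q κ ≡ suc (index p q κ′)) where

  private
    N = order p q

    ==-vertexAt : ∀ {v} → v < N → v ≢ index p q κ → (vertexAt p q v == κ) ≡ false
    ==-vertexAt v<n v≢κ = ==-≢ _ κ (vertexAt-≢ p q v<n κ v≢κ)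

    at-index : ∀ κ → IsVertex p q κ → ∀ u → atIndices p q E (index p q κ) u ≡ E κ (vertexAt p q u)
    at-index κ κ∈H u = cong (λ c → E c (vertexAt p q u)) (vertexAt-index p q κ κ∈H)

  det-addRow : det N (matrix N (atIndices p q (addRow κ κ′ c E))) ≡ det N (matrix N (atIndices p q E))
  det-addRow = det-add-rowℕ N (atIndices p q E) (atIndices p q (addRow κ κ′ c E)) c
    (index<order p q κ κ∈H) (index<order p q κ′ κ′∈H) adj
    (λ u → begin
      addRow κ κ′ c E (vertexAt p q (index p q κ)) (vertexAt p q u)
        ≡⟨ cong (λ c₁ → addRow κ κ′ c E c₁ (vertexAt p q u)) (vertexAt-index p q κ κ∈H) ⟩
      addRow κ κ′ c E κ (vertexAt p q u)
        ≡⟨ addRow-on κ κ′ c E κ (vertexAt p q u) (==-refl κ) ⟩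
      E κ (vertexAt p q u) + c * E κ′ (vertexAt p q u)
        ≡⟨ cong₂ (λ a b → a + c * b) (at-index κ κ∈H u) (at-index κ′ κ′∈H u) ⟨
      atIndices p q E (index p q κ) u + c * atIndices p q E (index p q κ′) u ∎)
    (λ v u v<n v≢κ → addRow-off κ κ′ c E _ _ (==-vertexAt v<n v≢κ))
    where open ≡-Reasoning

  det-addColumn : det N (matrix N (atIndices p q (addColumn κ κ′ c E))) ≡ det N (matrix N (atIndices p q E))
  det-addColumn = det-add-columnℕ N (atIndices p q E) (atIndices p q (addColumn κ κ′ c E)) c
    (index<order p q κ κ∈H) (index<order p q κ′ κ′∈H) adj
    (λ v → begin
      addColumn κ κ′ c E (vertexAt p q v) (vertexAt p q (index p q κ))
        ≡⟨ cong (addColumn κ κ′ c E (vertexAt p q v)) (vertexAt-index p q κ κ∈H) ⟩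
      addColumn κ κ′ c E (vertexAt p q v) κ
        ≡⟨ addColumn-on κ κ′ c E (vertexAt p q v) κ (==-refl κ) ⟩
      E (vertexAt p q v) κ + c * E (vertexAt p q v) κ′
        ≡⟨ cong₂ (λ a b → E (vertexAt p q v) a + c * E (vertexAt p q v) b)
                 (vertexAt-index p q κ κ∈H) (vertexAt-index p q κ′ κ′∈H) ⟨
      atIndices p q E v (index p q κ) + c * atIndices p q E v (index p q κ′) ∎)
    (λ v u u<n u≢κ → addColumn-off κ κ′ c E _ _ (==-vertexAt u<n u≢κ))
    where open ≡-Reasoning

-- Branch q₁ = q₀ + 1 is merged into branch q₀ (which becomes the last branch).
module MergeBranches (p q₀ : ℕ) (w t x : ℤ) where

  q₁ = suc q₀
  E₀ = reduced p (suc q₁) w t x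
  E₁ = addColumn (inner q₁) (inner q₀) (- + 1) E₀
  E₂ = addColumn (outer q₁) (outer q₀) (- + 1) E₁
  E₃ = addRow (inner q₀) (inner q₁) (+ 1) E₂
  E₄ = addRow (outer q₀) (outer q₁) (+ 1) E₃
  E′ = reduced p q₁ w (t + + 1) x

  private
    q₀≡q₀ : (q₀ ≡ᵇ q₀) ≡ true
    q₀≡q₀ = ≡ᵇ-refl q₀
    q₀≢q₁ : (q₀ ≡ᵇ q₁) ≡ false
    q₀≢q₁ = ≡ᵇ-≢ q₀ q₁ (ℕ.<⇒≢ ℕ.≤-refl)
    q₁≢q₀ : (q₁ ≡ᵇ q₀) ≡ false
    q₁≢q₀ = ≡ᵇ-≢ q₁ q₀ (ℕ.<⇒≢ ℕ.≤-refl ∘ sym)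

  E₂-column : ∀ c c₂ → IsVertex p q₁ c₂ → E₂ c c₂ ≡ E₀ c c₂
  E₂-column c centre     _    = refl
  E₂-column c (leaf _)   _    = refl
  E₂-column c (inner j₂) j₂<q = addColumn-off (inner q₁) (inner q₀) (- + 1) E₀ c (inner j₂) (≡ᵇ-≢ j₂ q₁ (ℕ.<⇒≢ j₂<q))
  E₂-column c (outer j₂) j₂<q = addColumn-off (outer q₁) (outer q₀) (- + 1) E₁ c (outer j₂) (≡ᵇ-≢ j₂ q₁ (ℕ.<⇒≢ j₂<q))

  private
    ring-merge : ∀ a b → a + + 1 * b ≡ a + b
    ring-merge = solve-∀

  row-centre : ∀ c₂ → E₀ centre c₂ ≡ E′ centre c₂
  row-centre centre    = refl
  row-centre (leaf _)  = refl
  row-centre (inner _) = refl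
  row-centre (outer _) = refl

  row-leaf : ∀ i c₂ → E₀ (leaf i) c₂ ≡ E′ (leaf i) c₂
  row-leaf i centre    = refl
  row-leaf i (leaf _)  = refl
  row-leaf i (inner _) = refl
  row-leaf i (outer _) = refl

  module _ (j : ℕ) (j≢q₀ : j ≢ q₀) (j≢q₁ : j ≢ q₁) where
    row-inner : ∀ c₂ → E₀ (inner j) c₂ ≡ E′ (inner j) c₂
    row-inner centre     = refl
    row-inner (leaf _)   = refl
    row-inner (inner _)  = refl
    row-inner (outer j₂) rewrite ≡ᵇ-≢ j q₀ j≢q₀ | ≡ᵇ-≢ j q₁ j≢q₁ = refl

    row-outer : ∀ c₂ → E₀ (outer j) c₂ ≡ E′ (outer j) c₂
    row-outer centre     rewrite ≡ᵇ-≢ j q₀ j≢q₀ | ≡ᵇ-≢ j q₁ j≢q₁ = refl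
    row-outer (leaf _)   rewrite ≡ᵇ-≢ j q₀ j≢q₀ | ≡ᵇ-≢ j q₁ j≢q₁ = refl
    row-outer (inner j₂) rewrite ≡ᵇ-≢ j q₀ j≢q₀ | ≡ᵇ-≢ j q₁ j≢q₁ = refl
    row-outer (outer j₂) rewrite ≡ᵇ-≢ j q₀ j≢q₀ | ≡ᵇ-≢ j q₁ j≢q₁ = refl

  merged-branch : ∀ j₂ → j₂ < q₁ → branchEntry (suc q₁) t q₀ j₂ + branchEntry (suc q₁) t q₁ j₂ ≡ branchEntry q₁ (t + + 1) q₀ j₂
  merged-branch j₂ j₂<q₁ with j₂ ℕ.≟ q₀
  ... | yes refl rewrite q₀≡q₀ | q₀≢q₁ | q₁≢q₀ = ring t
    where ring : ∀ t → + 0 + - (+ 3 * t) ≡ - (+ 3 * ((t + + 1) - + 1))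
          ring = solve-∀
  ... | no j₂≢q₀ rewrite q₀≡q₀ | q₀≢q₁ | ≡ᵇ-≢ q₀ j₂ (j₂≢q₀ ∘ sym) | ≡ᵇ-≢ q₁ j₂ (ℕ.<⇒≢ j₂<q₁ ∘ sym) = ring t
    where ring : ∀ t → - + 3 + - (+ 3 * t) ≡ - (+ 3 * (t + + 1))
          ring = solve-∀

  merged-inner : ∀ c₂ → IsVertex p q₁ c₂ → E₀ (inner q₀) c₂ + E₀ (inner q₁) c₂ ≡ E′ (inner q₀) c₂
  merged-inner centre     _      = refl
  merged-inner (leaf _)   _      = refl
  merged-inner (inner j₂) j₂<q₁ rewrite ≡ᵇ-≢ q₁ j₂ (ℕ.<⇒≢ j₂<q₁ ∘ sym) = ℤ.+-identityʳ _
  merged-inner (outer j₂) j₂<q₁ = merged-branch j₂ j₂<q₁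

  merged-outer : ∀ c₂ → IsVertex p q₁ c₂ → E₀ (outer q₀) c₂ + E₀ (outer q₁) c₂ ≡ E′ (outer q₀) c₂
  merged-outer centre     _ rewrite q₀≢q₁ | q₀≡q₀ = ring t
    where ring : ∀ t → - + 2 + - (+ 2 * t) ≡ - (+ 2 * (t + + 1))
          ring = solve-∀
  merged-outer (leaf _)   _ rewrite q₀≢q₁ | q₀≡q₀ = ring t
    where ring : ∀ t → - + 3 + - (+ 3 * t) ≡ - (+ 3 * (t + + 1))
          ring = solve-∀
  merged-outer (inner j₂) j₂<q₁ = merged-branch j₂ j₂<q₁
  merged-outer (outer j₂) j₂<q₁ with j₂ ℕ.≟ q₀
  ... | yes refl rewrite q₀≡q₀ | q₀≢q₁ | q₁≢q₀ = ring x t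
    where ring : ∀ x t → x + - (+ 4 * t) ≡ x - + 4 * ((t + + 1) - + 1)
          ring = solve-∀
  ... | no j₂≢q₀ rewrite q₀≡q₀ | q₀≢q₁ | ≡ᵇ-≢ q₀ j₂ (j₂≢q₀ ∘ sym) | ≡ᵇ-≢ q₁ j₂ (ℕ.<⇒≢ j₂<q₁ ∘ sym) = ring t
    where ring : ∀ t → - + 4 + - (+ 4 * t) ≡ - (+ 4 * (t + + 1))
          ring = solve-∀

  restriction : ∀ c₁ c₂ → IsVertex p q₁ c₁ → IsVertex p q₁ c₂ → E₄ c₁ c₂ ≡ E′ c₁ c₂
  restriction centre    c₂ _ c₂∈H = trans (E₂-column centre c₂ c₂∈H) (row-centre c₂)
  restriction (leaf i)  c₂ _ c₂∈H = trans (E₂-column (leaf i) c₂ c₂∈H) (row-leaf i c₂)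
  restriction (inner j) c₂ j<q₁ c₂∈H with j ℕ.≟ q₀
  ... | yes refl = begin
    E₄ (inner q₀) c₂                            ≡⟨ addRow-on (inner q₀) (inner q₁) (+ 1) E₂ (inner q₀) c₂ q₀≡q₀ ⟩
    E₂ (inner q₀) c₂ + + 1 * E₂ (inner q₁) c₂   ≡⟨ cong₂ (λ a b → a + + 1 * b) (E₂-column (inner q₀) c₂ c₂∈H) (E₂-column (inner q₁) c₂ c₂∈H) ⟩
    E₀ (inner q₀) c₂ + + 1 * E₀ (inner q₁) c₂   ≡⟨ ring-merge (E₀ (inner q₀) c₂) (E₀ (inner q₁) c₂) ⟩
    E₀ (inner q₀) c₂ + E₀ (inner q₁) c₂         ≡⟨ merged-inner c₂ c₂∈H ⟩
    E′ (inner q₀) c₂                            ∎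
    where open ≡-Reasoning
  ... | no j≢q₀ = trans (addRow-off (inner q₀) (inner q₁) (+ 1) E₂ (inner j) c₂ (≡ᵇ-≢ j q₀ j≢q₀))
                        (trans (E₂-column (inner j) c₂ c₂∈H) (row-inner j j≢q₀ (ℕ.<⇒≢ j<q₁) c₂))
  restriction (outer j) c₂ j<q₁ c₂∈H with j ℕ.≟ q₀
  ... | yes refl = begin
    E₄ (outer q₀) c₂                            ≡⟨ addRow-on (outer q₀) (outer q₁) (+ 1) E₃ (outer q₀) c₂ q₀≡q₀ ⟩
    E₂ (outer q₀) c₂ + + 1 * E₂ (outer q₁) c₂   ≡⟨ cong₂ (λ a b → a + + 1 * b) (E₂-column (outer q₀) c₂ c₂∈H) (E₂-column (outer q₁) c₂ c₂∈H) ⟩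
    E₀ (outer q₀) c₂ + + 1 * E₀ (outer q₁) c₂   ≡⟨ ring-merge (E₀ (outer q₀) c₂) (E₀ (outer q₁) c₂) ⟩
    E₀ (outer q₀) c₂ + E₀ (outer q₁) c₂         ≡⟨ merged-outer c₂ c₂∈H ⟩
    E′ (outer q₀) c₂                            ∎
    where open ≡-Reasoning
  ... | no j≢q₀ = trans (addRow-off (outer q₀) (outer q₁) (+ 1) E₃ (outer j) c₂ (≡ᵇ-≢ j q₀ j≢q₀))
                        (trans (E₂-column (outer j) c₂ c₂∈H) (row-outer j j≢q₀ (ℕ.<⇒≢ j<q₁) c₂))

  column-inner : ∀ c → E₂ c (inner q₁) ≡ E₀ c (inner q₁) + - + 1 * E₀ c (inner q₀)
  column-inner c = addColumn-on (inner q₁) (inner q₀) (- + 1) E₀ c (inner q₁) q₀≡q₀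

  column-outer : ∀ c → E₂ c (outer q₁) ≡ E₀ c (outer q₁) + - + 1 * E₀ c (outer q₀)
  column-outer c = addColumn-on (outer q₁) (outer q₀) (- + 1) E₁ c (outer q₁) q₀≡q₀

  private
    merged-inner-inner : (E₀ (inner q₀) (inner q₁) + - + 1 * E₀ (inner q₀) (inner q₀))
                         + + 1 * (E₀ (inner q₁) (inner q₁) + - + 1 * E₀ (inner q₁) (inner q₀)) ≡ + 0
    merged-inner-inner rewrite q₀≡q₀ | q₀≢q₁ | q₁≢q₀ = ring x
      where ring : ∀ x → (+ 0 + - + 1 * x) + + 1 * (x + - + 1 * + 0) ≡ + 0
            ring = solve-∀

    merged-outer-inner : (E₀ (outer q₀) (inner q₁) + - + 1 * E₀ (outer q₀) (inner q₀))
                         + + 1 * (E₀ (outer q₁) (inner q₁) + - + 1 * E₀ (outer q₁) (inner q₀)) ≡ + 0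
    merged-outer-inner rewrite q₀≡q₀ | q₀≢q₁ | q₁≢q₀ = ring t
      where ring : ∀ t → (- + 3 + - + 1 * + 0) + + 1 * (- (+ 3 * (t - + 1)) + - + 1 * - (+ 3 * t)) ≡ + 0
            ring = solve-∀

    merged-inner-outer : (E₀ (inner q₀) (outer q₁) + - + 1 * E₀ (inner q₀) (outer q₀))
                         + + 1 * (E₀ (inner q₁) (outer q₁) + - + 1 * E₀ (inner q₁) (outer q₀)) ≡ + 0
    merged-inner-outer rewrite q₀≡q₀ | q₀≢q₁ | q₁≢q₀ = ring t
      where ring : ∀ t → (- + 3 + - + 1 * + 0) + + 1 * (- (+ 3 * (t - + 1)) + - + 1 * - (+ 3 * t)) ≡ + 0
            ring = solve-∀

    merged-outer-outer : (E₀ (outer q₀) (outer q₁) + - + 1 * E₀ (outer q₀) (outer q₀))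
                         + + 1 * (E₀ (outer q₁) (outer q₁) + - + 1 * E₀ (outer q₁) (outer q₀)) ≡ + 0
    merged-outer-outer rewrite q₀≡q₀ | q₀≢q₁ | q₁≢q₀ = ring x t
      where ring : ∀ x t → (- + 4 + - + 1 * x) + + 1 * ((x - + 4 * (t - + 1)) + - + 1 * - (+ 4 * t)) ≡ + 0
            ring = solve-∀

  column-inner-vanishes : ∀ c → IsVertex p (suc q₁) c → c ≢ inner q₁ → c ≢ outer q₁ → E₄ c (inner q₁) ≡ + 0
  column-inner-vanishes centre    _ _ _ = column-inner centre
  column-inner-vanishes (leaf i)  _ _ _ = column-inner (leaf i)
  column-inner-vanishes (inner j) _ j≢q₁ _ with j ℕ.≟ q₀
  ... | yes refl = trans (addRow-on (inner q₀) (inner q₁) (+ 1) E₂ (inner q₀) (inner q₁) q₀≡q₀)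
                         (trans (cong₂ (λ a b → a + + 1 * b) (column-inner (inner q₀)) (column-inner (inner q₁))) merged-inner-inner)
  ... | no j≢q₀ rewrite addRow-off (inner q₀) (inner q₁) (+ 1) E₂ (inner j) (inner q₁) (≡ᵇ-≢ j q₀ j≢q₀)
                      | column-inner (inner j) | ≡ᵇ-≢ j q₀ j≢q₀ | ≡ᵇ-≢ j q₁ (j≢q₁ ∘ cong inner) = refl
  column-inner-vanishes (outer j) _ _ j≢q₁ with j ℕ.≟ q₀
  ... | yes refl = trans (addRow-on (outer q₀) (outer q₁) (+ 1) E₃ (outer q₀) (inner q₁) q₀≡q₀)
                         (trans (cong₂ (λ a b → a + + 1 * b) (column-inner (outer q₀)) (column-inner (outer q₁))) merged-outer-inner)
  ... | no j≢q₀ rewrite addRow-off (outer q₀) (outer q₁) (+ 1) E₃ (outer j) (inner q₁) (≡ᵇ-≢ j q₀ j≢q₀)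
                      | column-inner (outer j) | ≡ᵇ-≢ j q₀ j≢q₀ | ≡ᵇ-≢ j q₁ (j≢q₁ ∘ cong outer) = refl

  column-outer-vanishes : ∀ c → IsVertex p (suc q₁) c → c ≢ inner q₁ → c ≢ outer q₁ → E₄ c (outer q₁) ≡ + 0
  column-outer-vanishes centre    _ _ _ = column-outer centre
  column-outer-vanishes (leaf i)  _ _ _ = trans (column-outer (leaf i)) (cancel (if i ≡ᵇ pred p then - w else - + 3))
    where cancel : ∀ a → a + - + 1 * a ≡ + 0
          cancel = solve-∀
  column-outer-vanishes (inner j) _ j≢q₁ _ with j ℕ.≟ q₀
  ... | yes refl = trans (addRow-on (inner q₀) (inner q₁) (+ 1) E₂ (inner q₀) (outer q₁) q₀≡q₀)
                         (trans (cong₂ (λ a b → a + + 1 * b) (column-outer (inner q₀)) (column-outer (inner q₁))) merged-inner-outer)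
  ... | no j≢q₀ rewrite addRow-off (inner q₀) (inner q₁) (+ 1) E₂ (inner j) (outer q₁) (≡ᵇ-≢ j q₀ j≢q₀)
                      | column-outer (inner j) | ≡ᵇ-≢ j q₀ j≢q₀ | ≡ᵇ-≢ j q₁ (j≢q₁ ∘ cong inner) = refl
  column-outer-vanishes (outer j) _ _ j≢q₁ with j ℕ.≟ q₀
  ... | yes refl = trans (addRow-on (outer q₀) (outer q₁) (+ 1) E₃ (outer q₀) (outer q₁) q₀≡q₀)
                         (trans (cong₂ (λ a b → a + + 1 * b) (column-outer (outer q₀)) (column-outer (outer q₁))) merged-outer-outer)
  ... | no j≢q₀ rewrite addRow-off (outer q₀) (outer q₁) (+ 1) E₃ (outer j) (outer q₁) (≡ᵇ-≢ j q₀ j≢q₀)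
                      | column-outer (outer j) | ≡ᵇ-≢ j q₀ j≢q₀ | ≡ᵇ-≢ j q₁ (j≢q₁ ∘ cong outer) = refl

  private
    three : ∀ t → - (+ 3 * (t - + 1)) + - + 1 * - (+ 3 * t) ≡ + 3
    three = solve-∀

  block-inner-inner : E₄ (inner q₁) (inner q₁) ≡ x
  block-inner-inner rewrite addRow-off (inner q₀) (inner q₁) (+ 1) E₂ (inner q₁) (inner q₁) q₁≢q₀
                          | column-inner (inner q₁) | q₀≡q₀ | q₁≢q₀ = ℤ.+-identityʳ x

  block-inner-outer : E₄ (inner q₁) (outer q₁) ≡ + 3
  block-inner-outer rewrite addRow-off (inner q₀) (inner q₁) (+ 1) E₂ (inner q₁) (outer q₁) q₁≢q₀
                          | column-outer (inner q₁) | q₀≡q₀ | q₁≢q₀ = three t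

  block-outer-inner : E₄ (outer q₁) (inner q₁) ≡ + 3
  block-outer-inner rewrite addRow-off (outer q₀) (outer q₁) (+ 1) E₃ (outer q₁) (inner q₁) q₁≢q₀
                          | column-inner (outer q₁) | q₀≡q₀ | q₁≢q₀ = three t

  block-outer-outer : E₄ (outer q₁) (outer q₁) ≡ x + + 4
  block-outer-outer rewrite addRow-off (outer q₀) (outer q₁) (+ 1) E₃ (outer q₁) (outer q₁) q₁≢q₀
                          | column-outer (outer q₁) | q₀≡q₀ | q₁≢q₀ = ring x t
    where ring : ∀ x t → (x - + 4 * (t - + 1)) + - + 1 * - (+ 4 * t) ≡ x + + 4
          ring = solve-∀

  block : E₄ (inner q₁) (inner q₁) * E₄ (outer q₁) (outer q₁) - E₄ (inner q₁) (outer q₁) * E₄ (outer q₁) (inner q₁)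
          ≡ x * x + + 4 * x - + 9
  block = trans (cong₂ _-_ (cong₂ _*_ block-inner-inner block-outer-outer) (cong₂ _*_ block-inner-outer block-outer-inner))
                (ring x)
    where ring : ∀ x → x * (x + + 4) - + 3 * + 3 ≡ x * x + + 4 * x - + 9
          ring = solve-∀

-- Leaf p₁ = p₀ + 1 is merged into leaf p₀ (which becomes the last leaf).
module MergeLeaves (p₀ q : ℕ) (w t x : ℤ) where

  p₁ = suc p₀
  E₀ = reduced (suc p₁) q w t x
  E₁ = addColumn (leaf p₁) (leaf p₀) (- + 1) E₀
  E₂ = addRow (leaf p₀) (leaf p₁) (+ 1) E₁
  E′ = reduced p₁ q (w + + 3) t x

  private
    p₀≡p₀ : (p₀ ≡ᵇ p₀) ≡ true
    p₀≡p₀ = ≡ᵇ-refl p₀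
    p₀≢p₁ : (p₀ ≡ᵇ p₁) ≡ false
    p₀≢p₁ = ≡ᵇ-≢ p₀ p₁ (ℕ.<⇒≢ ℕ.≤-refl)
    p₁≢p₀ : (p₁ ≡ᵇ p₀) ≡ false
    p₁≢p₀ = ≡ᵇ-≢ p₁ p₀ (ℕ.<⇒≢ ℕ.≤-refl ∘ sym)

  E₁-column : ∀ c c₂ → IsVertex p₁ q c₂ → E₁ c c₂ ≡ E₀ c c₂
  E₁-column c centre    _    = refl
  E₁-column c (leaf i₂) i₂<p = addColumn-off (leaf p₁) (leaf p₀) (- + 1) E₀ c (leaf i₂) (≡ᵇ-≢ i₂ p₁ (ℕ.<⇒≢ i₂<p))
  E₁-column c (inner _) _    = refl
  E₁-column c (outer _) _    = refl

  private
    unchanged : ∀ c c₂ → (∀ i → c ≢ leaf i) → E₀ c c₂ ≡ E′ c c₂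
    unchanged centre    centre    _ = refl
    unchanged centre    (leaf _)  _ = refl
    unchanged centre    (inner _) _ = refl
    unchanged centre    (outer _) _ = refl
    unchanged (leaf i)  _         c≢leaf = ⊥-elim (c≢leaf i refl)
    unchanged (inner _) centre    _ = refl
    unchanged (inner _) (leaf _)  _ = refl
    unchanged (inner _) (inner _) _ = refl
    unchanged (inner _) (outer _) _ = refl
    unchanged (outer _) centre    _ = refl
    unchanged (outer _) (leaf _)  _ = refl
    unchanged (outer _) (inner _) _ = refl
    unchanged (outer _) (outer _) _ = refl

    unchanged-leaf : ∀ i c₂ → i ≢ p₀ → i ≢ p₁ → E₀ (leaf i) c₂ ≡ E′ (leaf i) c₂
    unchanged-leaf i centre    _     _     = refl
    unchanged-leaf i (leaf _)  _     _     = refl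
    unchanged-leaf i (inner _) _     _     = refl
    unchanged-leaf i (outer _) i≢p₀ i≢p₁ rewrite ≡ᵇ-≢ i p₀ i≢p₀ | ≡ᵇ-≢ i p₁ i≢p₁ = refl

    merged-leaf : ∀ c₂ → IsVertex p₁ q c₂ → E₀ (leaf p₀) c₂ + + 1 * E₀ (leaf p₁) c₂ ≡ E′ (leaf p₀) c₂
    merged-leaf centre     _     = refl
    merged-leaf (leaf i₂)  i₂<p rewrite ≡ᵇ-≢ p₁ i₂ (ℕ.<⇒≢ i₂<p ∘ sym) = ring (if p₀ ≡ᵇ i₂ then x else + 0)
      where ring : ∀ a → a + + 1 * + 0 ≡ a
            ring = solve-∀
    merged-leaf (inner _)  _     = refl
    merged-leaf (outer _)  _ rewrite p₀≡p₀ | p₀≢p₁ = ring w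
      where ring : ∀ w → - + 3 + + 1 * - w ≡ - (w + + 3)
            ring = solve-∀

  restriction : ∀ c₁ c₂ → IsVertex p₁ q c₁ → IsVertex p₁ q c₂ → E₂ c₁ c₂ ≡ E′ c₁ c₂
  restriction centre    c₂ _ c₂∈H = trans (E₁-column centre c₂ c₂∈H) (unchanged centre c₂ λ _ ())
  restriction (inner j) c₂ _ c₂∈H = trans (E₁-column (inner j) c₂ c₂∈H) (unchanged (inner j) c₂ λ _ ())
  restriction (outer j) c₂ _ c₂∈H = trans (E₁-column (outer j) c₂ c₂∈H) (unchanged (outer j) c₂ λ _ ())
  restriction (leaf i)  c₂ i<p₁ c₂∈H with i ℕ.≟ p₀
  ... | yes refl = begin
    E₂ (leaf p₀) c₂                           ≡⟨ addRow-on (leaf p₀) (leaf p₁) (+ 1) E₁ (leaf p₀) c₂ p₀≡p₀ ⟩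
    E₁ (leaf p₀) c₂ + + 1 * E₁ (leaf p₁) c₂   ≡⟨ cong₂ (λ a b → a + + 1 * b) (E₁-column (leaf p₀) c₂ c₂∈H) (E₁-column (leaf p₁) c₂ c₂∈H) ⟩
    E₀ (leaf p₀) c₂ + + 1 * E₀ (leaf p₁) c₂   ≡⟨ merged-leaf c₂ c₂∈H ⟩
    E′ (leaf p₀) c₂                           ∎
    where open ≡-Reasoning
  ... | no i≢p₀ = trans (addRow-off (leaf p₀) (leaf p₁) (+ 1) E₁ (leaf i) c₂ (≡ᵇ-≢ i p₀ i≢p₀))
                        (trans (E₁-column (leaf i) c₂ c₂∈H) (unchanged-leaf i c₂ i≢p₀ (ℕ.<⇒≢ i<p₁)))

  column-leaf : ∀ c → E₁ c (leaf p₁) ≡ E₀ c (leaf p₁) + - + 1 * E₀ c (leaf p₀)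
  column-leaf c = addColumn-on (leaf p₁) (leaf p₀) (- + 1) E₀ c (leaf p₁) p₀≡p₀

  column-leaf-vanishes : ∀ c → IsVertex (suc p₁) q c → c ≢ leaf p₁ → E₂ c (leaf p₁) ≡ + 0
  column-leaf-vanishes centre    _ _ = column-leaf centre
  column-leaf-vanishes (inner j) _ _ = column-leaf (inner j)
  column-leaf-vanishes (outer j) _ _ = trans (column-leaf (outer j)) (cancel (if j ≡ᵇ pred q then - (+ 3 * t) else - + 3))
    where cancel : ∀ a → a + - + 1 * a ≡ + 0
          cancel = solve-∀
  column-leaf-vanishes (leaf i)  _ i≢p₁ with i ℕ.≟ p₀
  ... | yes refl = trans (addRow-on (leaf p₀) (leaf p₁) (+ 1) E₁ (leaf p₀) (leaf p₁) p₀≡p₀)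
                         (trans (cong₂ (λ a b → a + + 1 * b) (column-leaf (leaf p₀)) (column-leaf (leaf p₁))) merged)
    where
    merged : (E₀ (leaf p₀) (leaf p₁) + - + 1 * E₀ (leaf p₀) (leaf p₀)) + + 1 * (E₀ (leaf p₁) (leaf p₁) + - + 1 * E₀ (leaf p₁) (leaf p₀)) ≡ + 0
    merged rewrite p₀≡p₀ | p₀≢p₁ | p₁≢p₀ = ring x
      where ring : ∀ x → (+ 0 + - + 1 * x) + + 1 * (x + - + 1 * + 0) ≡ + 0
            ring = solve-∀
  ... | no i≢p₀ rewrite addRow-off (leaf p₀) (leaf p₁) (+ 1) E₁ (leaf i) (leaf p₁) (≡ᵇ-≢ i p₀ i≢p₀)
                      | column-leaf (leaf i) | ≡ᵇ-≢ i p₀ i≢p₀ | ≡ᵇ-≢ i p₁ (i≢p₁ ∘ cong leaf) = refl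

  diagonal-leaf : E₂ (leaf p₁) (leaf p₁) ≡ x
  diagonal-leaf rewrite addRow-off (leaf p₀) (leaf p₁) (+ 1) E₁ (leaf p₁) (leaf p₁) p₁≢p₀
                      | column-leaf (leaf p₁) | p₀≡p₀ | p₁≢p₀ = ℤ.+-identityʳ x

reducedDet : ℕ → ℕ → ℤ → ℤ → ℤ → ℤ
reducedDet p q w t x = det (order p q) (matrix (order p q) (atIndices p q (reduced p q w t x)))

merge-branches : ∀ p q₀ w t x →
  reducedDet p (suc (suc q₀)) w t x ≡ (x * x + + 4 * x - + 9) * reducedDet p (suc q₀) w (t + + 1) x
merge-branches p q₀ w t x = begin
  det N (matrix N (at E₀))   ≡⟨ det-addColumn p q E₀ (inner q₁) (inner q₀) (- + 1) inner₁∈H inner₀∈H (inj₂ inner-adjacent) ⟨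
  det N (matrix N (at E₁))   ≡⟨ det-addColumn p q E₁ (outer q₁) (outer q₀) (- + 1) outer₁∈H outer₀∈H (inj₂ outer-adjacent) ⟨
  det N (matrix N (at E₂))   ≡⟨ det-addRow p q E₂ (inner q₀) (inner q₁) (+ 1) inner₀∈H inner₁∈H (inj₁ inner-adjacent) ⟨
  det N (matrix N (at E₃))   ≡⟨ det-addRow p q E₃ (outer q₀) (outer q₁) (+ 1) outer₀∈H outer₁∈H (inj₁ outer-adjacent) ⟨
  det N (matrix N (at E₄))   ≡⟨ det-block m (at E₄) a<m+1 column-a column-last ⟩
  (at E₄ a a * at E₄ (suc m) (suc m) - at E₄ a (suc m) * at E₄ (suc m) a) * det m (matrix m (minorℕ (at E₄) a a))
                             ≡⟨ cong₂ _*_ block-value minor-value ⟩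
  (x * x + + 4 * x - + 9) * reducedDet p q₁ w (t + + 1) x ∎
  where
  open ≡-Reasoning
  open MergeBranches p q₀ w t x
  q = suc q₁
  m = order p q₁
  N = order p q
  at = atIndices p q
  a = index p q (inner q₁)
  inner₀∈H : IsVertex p q (inner q₀)
  inner₀∈H = ℕ.m≤n⇒m≤1+n ℕ.≤-refl
  inner₁∈H : IsVertex p q (inner q₁)
  inner₁∈H = ℕ.≤-refl
  outer₀∈H = inner₀∈H
  outer₁∈H = inner₁∈H
  inner-adjacent : index p q (inner q₁) ≡ suc (index p q (inner q₀))
  inner-adjacent = cong suc (ℕ.+-suc p q₀)
  outer-adjacent : index p q (outer q₁) ≡ suc (index p q (outer q₀))
  outer-adjacent = cong suc (trans (cong (p ℕ.+_) (ℕ.+-suc q q₀)) (ℕ.+-suc p (q ℕ.+ q₀)))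
  outer₁-last : index p q (outer q₁) ≡ suc m
  outer₁-last = cong suc (trans (ℕ.+-suc p (q₁ ℕ.+ q₁)) (sym (order≡ p q₁)))
  a<m+1 : a < suc m
  a<m+1 = s≤s (subst (p ℕ.+ q₁ <_) (sym (order≡ p q₁)) (s≤s (ℕ.+-monoʳ-≤ p (ℕ.m≤m+n q₁ q₁))))
  vertexAt-a : vertexAt p q a ≡ inner q₁
  vertexAt-a = vertexAt-index p q (inner q₁) inner₁∈H
  vertexAt-last : vertexAt p q (suc m) ≡ outer q₁
  vertexAt-last = subst (λ k → vertexAt p q k ≡ outer q₁) outer₁-last (vertexAt-index p q (outer q₁) outer₁∈H)
  column-a : ∀ v → v < suc (suc m) → v ≢ a → v ≢ suc m → at E₄ v a ≡ + 0
  column-a v v<N v≢a v≢last = trans (cong (E₄ (vertexAt p q v)) vertexAt-a)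
    (column-inner-vanishes (vertexAt p q v) (vertexAt-isVertex p q v<N) (vertexAt-≢ p q v<N (inner q₁) v≢a)
                           (vertexAt-≢ p q v<N (outer q₁) (v≢last ∘ (λ e → trans e outer₁-last))))
  column-last : ∀ v → v < suc (suc m) → v ≢ a → v ≢ suc m → at E₄ v (suc m) ≡ + 0
  column-last v v<N v≢a v≢last = trans (cong (E₄ (vertexAt p q v)) vertexAt-last)
    (column-outer-vanishes (vertexAt p q v) (vertexAt-isVertex p q v<N) (vertexAt-≢ p q v<N (inner q₁) v≢a)
                           (vertexAt-≢ p q v<N (outer q₁) (v≢last ∘ (λ e → trans e outer₁-last))))
  block-value : at E₄ a a * at E₄ (suc m) (suc m) - at E₄ a (suc m) * at E₄ (suc m) a ≡ x * x + + 4 * x - + 9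
  block-value rewrite vertexAt-a | vertexAt-last = block
  minor-value : det m (matrix m (minorℕ (at E₄) a a)) ≡ reducedDet p q₁ w (t + + 1) x
  minor-value = det-matrix-cong m λ v u v<m u<m →
    trans (cong₂ E₄ (vertexAt-skipLastInner p q₁ v<m) (vertexAt-skipLastInner p q₁ u<m))
          (restriction _ _ (vertexAt-isVertex p q₁ v<m) (vertexAt-isVertex p q₁ u<m))

merge-leaves : ∀ p₀ q w t x → reducedDet (suc (suc p₀)) q w t x ≡ x * reducedDet (suc p₀) q (w + + 3) t x
merge-leaves p₀ q w t x = begin
  det N (matrix N (at E₀))   ≡⟨ det-addColumn p q E₀ (leaf p₁) (leaf p₀) (- + 1) leaf₁∈H leaf₀∈H (inj₂ refl) ⟨
  det N (matrix N (at E₁))   ≡⟨ det-addRow p q E₁ (leaf p₀) (leaf p₁) (+ 1) leaf₀∈H leaf₁∈H (inj₁ refl) ⟨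
  det N (matrix N (at E₂))   ≡⟨ det-matrix-resize (at E₂) (order-suc p₁ q) ⟩
  det (suc m) (matrix (suc m) (at E₂))
                             ≡⟨ det-diagonal-entry-columnℕ m (at E₂) k<1+m column-k ⟩
  at E₂ k k * det m (matrix m (minorℕ (at E₂) k k))
                             ≡⟨ cong₂ _*_ (trans (cong₂ E₂ vertexAt-k vertexAt-k) diagonal-leaf) minor-value ⟩
  x * reducedDet p₁ q (w + + 3) t x ∎
  where
  open ≡-Reasoning
  open MergeLeaves p₀ q w t x
  p = suc p₁
  m = order p₁ q
  N = order p q
  at = atIndices p q
  k = index p q (leaf p₁)
  leaf₀∈H : IsVertex p q (leaf p₀)
  leaf₀∈H = ℕ.m≤n⇒m≤1+n ℕ.≤-refl
  leaf₁∈H : IsVertex p q (leaf p₁)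
  leaf₁∈H = ℕ.≤-refl
  N≡1+m : N ≡ suc m
  N≡1+m = order-suc p₁ q
  k<1+m : k < suc m
  k<1+m = subst (k <_) N≡1+m (index<order p q (leaf p₁) leaf₁∈H)
  vertexAt-k : vertexAt p q k ≡ leaf p₁
  vertexAt-k = vertexAt-index p q (leaf p₁) leaf₁∈H
  column-k : ∀ v → v < suc m → v ≢ k → at E₂ v k ≡ + 0
  column-k v v<1+m v≢k = trans (cong (E₂ (vertexAt p q v)) vertexAt-k)
    (column-leaf-vanishes (vertexAt p q v) (vertexAt-isVertex p q v<N) (vertexAt-≢ p q v<N (leaf p₁) v≢k))
    where v<N = subst (v <_) (sym N≡1+m) v<1+m
  minor-value : det m (matrix m (minorℕ (at E₂) k k)) ≡ reducedDet p₁ q (w + + 3) t x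
  minor-value = det-matrix-cong m λ v u v<m u<m →
    trans (cong₂ E₂ (vertexAt-skipLastLeaf p₁ q v<m) (vertexAt-skipLastLeaf p₁ q u<m))
          (restriction _ _ (vertexAt-isVertex p₁ q v<m) (vertexAt-isVertex p₁ q u<m))

iterate-branches : ∀ p k w t x →
  reducedDet p (suc k) w t x ≡ (x * x + + 4 * x - + 9) ^ k * reducedDet p 1 w (t + + k) x
iterate-branches p zero    w t x = sym (trans (ℤ.*-identityˡ _) (cong (λ s → reducedDet p 1 w s x) (ℤ.+-identityʳ t)))
iterate-branches p (suc k) w t x = begin
  reducedDet p (suc (suc k)) w t x
    ≡⟨ merge-branches p k w t x ⟩
  Y * reducedDet p (suc k) w (t + + 1) x
    ≡⟨ cong (Y *_) (iterate-branches p k w (t + + 1) x) ⟩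
  Y * (Y ^ k * reducedDet p 1 w (t + + 1 + + k) x)
    ≡⟨ ℤ.*-assoc Y (Y ^ k) _ ⟨
  Y ^ suc k * reducedDet p 1 w (t + + 1 + + k) x
    ≡⟨ cong (λ s → Y ^ suc k * reducedDet p 1 w s x) (ℤ.+-assoc t (+ 1) (+ k)) ⟩
  Y ^ suc k * reducedDet p 1 w (t + + suc k) x ∎
  where
  open ≡-Reasoning
  Y = x * x + + 4 * x - + 9

iterate-leaves : ∀ k q w t x → reducedDet (suc k) q w t x ≡ x ^ k * reducedDet 1 q (w + + 3 * + k) t x
iterate-leaves zero    q w t x = sym (trans (ℤ.*-identityˡ _) (cong (λ v → reducedDet 1 q v t x) (ring w)))
  where ring : ∀ w → w + + 3 * + 0 ≡ w
        ring = solve-∀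
iterate-leaves (suc k) q w t x = begin
  reducedDet (suc (suc k)) q w t x
    ≡⟨ merge-leaves k q w t x ⟩
  x * reducedDet (suc k) q (w + + 3) t x
    ≡⟨ cong (x *_) (iterate-leaves k q (w + + 3) t x) ⟩
  x * (x ^ k * reducedDet 1 q (w + + 3 + + 3 * + k) t x)
    ≡⟨ ℤ.*-assoc x (x ^ k) _ ⟨
  x ^ suc k * reducedDet 1 q (w + + 3 + + 3 * + k) t x
    ≡⟨ cong (λ v → x ^ suc k * reducedDet 1 q v t x) (ring w (+ k)) ⟩
  x ^ suc k * reducedDet 1 q (w + + 3 * + suc k) t x ∎
  where
  open ≡-Reasoning
  ring : ∀ w k → w + + 3 + + 3 * k ≡ w + + 3 * (+ 1 + k)
  ring = solve-∀

base-no-leaves : ∀ w t x →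
  reducedDet 0 1 w t x ≡ x * (x * x - + 4 * (t - + 1) * x - + 4 * t - + 9 * (t - + 1) * (t - + 1))
base-no-leaves w t x = trans (det-3 (matrix 3 (atIndices 0 1 (reduced 0 1 w t x)))) (expand t x)
  where
  expand : ∀ t x →
    x * (x * (x - + 4 * (t - + 1)) - - (+ 3 * (t - + 1)) * - (+ 3 * (t - + 1)))
    - + 0 * (+ 0 * (x - + 4 * (t - + 1)) - - (+ 3 * (t - + 1)) * - (+ 2 * t))
    + - + 2 * (+ 0 * - (+ 3 * (t - + 1)) - x * - (+ 2 * t))
    ≡ x * (x * x - + 4 * (t - + 1) * x - + 4 * t - + 9 * (t - + 1) * (t - + 1))
  expand = solve-∀

base-one-leaf : ∀ w t x →
  reducedDet 1 1 w t x ≡ x * x * (x * x - + 4 * (t - + 1) * x - + 4 * t - + 3 * w * t - + 9 * (t - + 1) * (t - + 1))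
base-one-leaf w t x =
  trans (det-4 M)
        (trans (cong₂ (λ A B → M (# 0) (# 0) * A - M (# 0) (# 1) * D₁ + M (# 0) (# 2) * D₂ - M (# 0) (# 3) * B)
                      (det-3 (minor M zero zero)) (det-3 (minor M zero (# 3))))
               (expand w t x D₁ D₂))
  where
  M = matrix 4 (atIndices 1 1 (reduced 1 1 w t x))
  D₁ = det 3 (minor M zero (# 1))
  D₂ = det 3 (minor M zero (# 2))
  expand : ∀ w t x D₁ D₂ →
    x * (x * (x * (x - + 4 * (t - + 1)) - - (+ 3 * (t - + 1)) * - (+ 3 * (t - + 1)))
         - + 0 * (+ 0 * (x - + 4 * (t - + 1)) - - (+ 3 * (t - + 1)) * - (+ 3 * t))
         + - w * (+ 0 * - (+ 3 * (t - + 1)) - x * - (+ 3 * t)))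
    - + 0 * D₁ + + 0 * D₂
    - - + 2 * (+ 0 * (+ 0 * - (+ 3 * (t - + 1)) - x * - (+ 3 * t))
               - x * (+ 0 * - (+ 3 * (t - + 1)) - x * - (+ 2 * t))
               + + 0 * (+ 0 * - (+ 3 * t) - + 0 * - (+ 2 * t)))
    ≡ x * x * (x * x - + 4 * (t - + 1) * x - + 4 * t - + 3 * w * t - + 9 * (t - + 1) * (t - + 1))
  expand = solve-∀

single-branch : ∀ p t x →
  reducedDet p 1 (+ 3) t x ≡ x ^ (p ℕ.+ 1) * (x * x - + 4 * (t - + 1) * x - + 4 * t - + 9 * + p * t - + 9 * (t - + 1) * (t - + 1))
single-branch p t x = trans (by-leaves p) (cong (_* Q) (sym (trans (ℤ.^-distribˡ-+-* x p 1) (cong (x ^ p *_) (ℤ.^-identityʳ x)))))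
  where
  Q = x * x - + 4 * (t - + 1) * x - + 4 * t - + 9 * + p * t - + 9 * (t - + 1) * (t - + 1)
  by-leaves : ∀ p → reducedDet p 1 (+ 3) t x
    ≡ x ^ p * x * (x * x - + 4 * (t - + 1) * x - + 4 * t - + 9 * + p * t - + 9 * (t - + 1) * (t - + 1))
  by-leaves zero = trans (base-no-leaves (+ 3) t x) (ring t x)
    where
    ring : ∀ s y → y * (y * y - + 4 * (s - + 1) * y - + 4 * s - + 9 * (s - + 1) * (s - + 1))
                   ≡ + 1 * y * (y * y - + 4 * (s - + 1) * y - + 4 * s - + 9 * + 0 * s - + 9 * (s - + 1) * (s - + 1))
    ring = solve-∀
  by-leaves (suc p₁) = begin
    reducedDet (suc p₁) 1 (+ 3) t x
      ≡⟨ iterate-leaves p₁ 1 (+ 3) t x ⟩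
    x ^ p₁ * reducedDet 1 1 (+ 3 + + 3 * + p₁) t x
      ≡⟨ cong (x ^ p₁ *_) (base-one-leaf (+ 3 + + 3 * + p₁) t x) ⟩
    _ ≡⟨ ring (x ^ p₁) (+ p₁) t x ⟩
    x ^ suc p₁ * x * (x * x - + 4 * (t - + 1) * x - + 4 * t - + 9 * + suc p₁ * t - + 9 * (t - + 1) * (t - + 1)) ∎
    where
    open ≡-Reasoning
    ring : ∀ X P s y →
      X * (y * y * (y * y - + 4 * (s - + 1) * y - + 4 * s - + 3 * (+ 3 + + 3 * P) * s - + 9 * (s - + 1) * (s - + 1)))
      ≡ y * X * y * (y * y - + 4 * (s - + 1) * y - + 4 * s - + 9 * (+ 1 + P) * s - + 9 * (s - + 1) * (s - + 1))
    ring = solve-∀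

-- The ε-polynomial

char-entry : ∀ p q x c c′ → (if c == c′ then x else + 0) - eccentricityEntry c c′ ≡ reduced p q (+ 3) (+ 1) x c c′
char-entry p q x centre    centre     = ℤ.+-identityʳ x
char-entry p q x centre    (leaf _)   = refl
char-entry p q x centre    (inner _)  = refl
char-entry p q x centre    (outer _)  = refl
char-entry p q x (leaf _)  centre     = refl
char-entry p q x (leaf i)  (leaf i′)  with i ≡ᵇ i′
... | true  = ℤ.+-identityʳ x
... | false = refl
char-entry p q x (leaf _)  (inner _)  = refl
char-entry p q x (leaf i)  (outer _)  with i ≡ᵇ pred p
... | true  = refl
... | false = refl
char-entry p q x (inner _) centre     = refl
char-entry p q x (inner _) (leaf _)   = refl
char-entry p q x (inner j) (inner j′) with j ≡ᵇ j′
... | true  = ℤ.+-identityʳ x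
... | false = refl
char-entry p q x (inner j) (outer j′) with j ≡ᵇ j′ | j ≡ᵇ pred q
... | true  | true  = refl
... | true  | false = refl
... | false | true  = refl
... | false | false = refl
char-entry p q x (outer j) centre     with j ≡ᵇ pred q
... | true  = refl
... | false = refl
char-entry p q x (outer j) (leaf _)   with j ≡ᵇ pred q
... | true  = refl
... | false = refl
char-entry p q x (outer j) (inner j′) with j ≡ᵇ j′ | j ≡ᵇ pred q
... | true  | true  = refl
... | true  | false = refl
... | false | true  = refl
... | false | false = refl
char-entry p q x (outer j) (outer j′) with j ≡ᵇ j′ | j ≡ᵇ pred q
... | true  | true  = refl
... | true  | false = ℤ.+-identityʳ x
... | false | true  = refl
... | false | false = refl

char-matrix : ∀ p q → 2 ≤ q → ∀ x u v →
  charMat (p ℕ.+ 2 ℕ.* q ℕ.+ 1) x (eccMatrix (H p q)) u v ≡ matrix _ (atIndices p q (reduced p q (+ 3) (+ 1) x)) u v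
char-matrix p q 2≤q x u v =
  trans (cong₂ (λ b e → (if b then x else + 0) - e) (⌊≟⌋-vertexOf p q u v) (eccMatrix-H p q 2≤q u v))
        (char-entry p q x (vertexOf p q u) (vertexOf p q v))

det-charMat-H : ∀ p q → 2 ≤ q → ∀ x →
  det (p ℕ.+ 2 ℕ.* q ℕ.+ 1) (charMat (p ℕ.+ 2 ℕ.* q ℕ.+ 1) x (eccMatrix (H p q))) ≡ reducedDet p q (+ 3) (+ 1) x
det-charMat-H p q 2≤q x =
  trans (det-cong _ (char-matrix p q 2≤q x))
        (det-matrix-resize (atIndices p q (reduced p q (+ 3) (+ 1) x)) (sym (order≡size p q)))

lemma3p2 : (p q : ℕ) → 2 ≤ q → (x : ℤ) →
    det (p ℕ.+ 2 ℕ.* q ℕ.+ 1) (charMat (p ℕ.+ 2 ℕ.* q ℕ.+ 1) x (eccMatrix (H p q)))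
      ≡ (x ^ (p ℕ.+ 1)) * ((x ^ 2 + + 4 * x - + 9) ^ (q ∸ 1))
          * (x ^ 2 + (+ 4 - + 4 * + q) * x
               - (+ 9 * + p * + q + + 9 * + q * + q + + 9 - + 14 * + q))
lemma3p2 p (suc zero) (s≤s ()) x
lemma3p2 p q@(suc k@(suc _)) 2≤q x = begin
  det (p ℕ.+ 2 ℕ.* q ℕ.+ 1) (charMat (p ℕ.+ 2 ℕ.* q ℕ.+ 1) x (eccMatrix (H p q)))
    ≡⟨ det-charMat-H p q 2≤q x ⟩
  reducedDet p q (+ 3) (+ 1) x
    ≡⟨ iterate-branches p k (+ 3) (+ 1) x ⟩
  (x * x + + 4 * x - + 9) ^ k * reducedDet p 1 (+ 3) t x
    ≡⟨ cong ((x * x + + 4 * x - + 9) ^ k *_) (single-branch p t x) ⟩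
  (x * x + + 4 * x - + 9) ^ k * (x ^ (p ℕ.+ 1) * Q (x * x))
    ≡⟨ collect (x ^ (p ℕ.+ 1)) ((x * x + + 4 * x - + 9) ^ k) (+ p) t x ⟩
  x ^ (p ℕ.+ 1) * (x * x + + 4 * x - + 9) ^ k * R (x * x)
    ≡⟨ cong (λ s → x ^ (p ℕ.+ 1) * (s + + 4 * x - + 9) ^ k * R s) (sym x²≡x*x) ⟩
  x ^ (p ℕ.+ 1) * (x ^ 2 + + 4 * x - + 9) ^ k * R (x ^ 2) ∎
  where
  open ≡-Reasoning
  -- + q, in the form produced by iterate-branches: converting between the two forms would
  -- unfold the determinant
  t = + 1 + + k
  Q R : ℤ → ℤ
  Q s = s - + 4 * (t - + 1) * x - + 4 * t - + 9 * + p * t - + 9 * (t - + 1) * (t - + 1)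
  R s = s + (+ 4 - + 4 * t) * x - (+ 9 * + p * t + + 9 * t * t + + 9 - + 14 * t)
  x²≡x*x : x ^ 2 ≡ x * x
  x²≡x*x = cong (x *_) (ℤ.*-identityʳ x)
  collect : ∀ X Y P T y →
    Y * (X * (y * y - + 4 * (T - + 1) * y - + 4 * T - + 9 * P * T - + 9 * (T - + 1) * (T - + 1)))
    ≡ X * Y * (y * y + (+ 4 - + 4 * T) * y - (+ 9 * P * T + + 9 * T * T + + 9 - + 14 * T))
  collect = solve-∀
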